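{- The following hold. (i) If positive integers $x_1,x_2,x_3$ are all even or all odd, then $N(CB(x_1,x_2,x_3))=F(x_1,x_2,x_3)$. (ii) If $o_1,o_2$ are odd, $e_1$ is even, and all are at least $2$, then $N(CB(o_1,o_2,e_1))=e_1F(o_1,o_2,e_1-1)+o_1o_2F(o_1-1,o_2-1,e_1)$. If $e_1,e_2$ are even, $o_1$ is odd, and all are at least $2$, then $N(CB(e_1,e_2,o_1))=o_1F(e_1,e_2,o_1-1)+e_1e_2F(e_1-1,e_2-1,o_1)$. (iii) If $e_1,e_2$ are even (positive), then $N(CB(e_1,e_2,1))=e_1e_2F(e_1-1,e_2-1,1)+N(C_{e_1}\vee C_{e_2})$. (iv) If $e_1$ is even and $o_1\ge3$ is odd, then $N(CB(e_1,o_1,1))=e_1F(e_1-1,o_1,1)+o_1N(C_{o_1-1}\vee C_{e_1})$. (v) If $e_1$ is even (positive), then $N(CB(e_1,1,1))=e_1F(e_1-1,1,1)+N(C_{e_1})$.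
   Context: $CB(x_1,x_2,x_3)$ is the graph consisting of two distinct vertices joined by three internally vertex-disjoint paths of lengths $x_1,x_2,x_3$. For positive integers $x_1,x_2,x_3$ all of the same parity, $F(x_1,x_2,x_3)$ first sorts the inputs so that $x_1\ge x_2\ge x_3$ and then equals $\sum_{j=0}^{x_3}\binom{x_3}{j}\binom{x_2}{\frac12(x_2-x_3)+j}\binom{x_1}{\frac12(x_1-x_3)+j}$. $C_m$ is the cycle with $m$ edges ($C_2$ being two vertices joined by two parallel edges) and $G\vee H$ is a graph obtained by identifying a vertex of $G$ with a vertex of $H$. For a finite connected graph $G=(V,E)$, possibly with parallel edges, $N(G)$ denotes the number of functions $f:V\to\mathbb{Z}$, modulo adding a common constant, such that $|f(u)-f(v)|\le1$ for every edge $uv$ and the edges with $|f(u)-f(v)|=1$ form a connected spanning subgraph; for simple $G$ this equals the number of facets of the symmetric edge polytope $P_G=\operatorname{conv}\{\pm(e_i-e_j):\{i,j\}\in E\}$. -}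

module Defs where

open import Level using (0ℓ)
open import Data.Bool using (Bool; true; false; if_then_else_)
open import Data.Unit using (⊤; tt)
open import Data.Nat as ℕ using (ℕ; zero; suc; _∸_; _<?_; _≤ᵇ_)
open import Data.Nat.Combinatorics using (_C_)
open import Data.Fin as Fin using (Fin; toℕ; fromℕ<)
open import Data.Integer as ℤ using (ℤ; ∣_∣; _-_)
import Data.Integer.Properties as ℤP
open import Data.Product using (Σ; ∃; _×_; _,_; proj₁; proj₂)
open import Data.Sum using (_⊎_; inj₁; inj₂)
open import Relation.Nullary using (yes; no)
open import Relation.Binary.Bundles using (Setoid)
open import Relation.Binary.PropositionalEquality as ≡ using (_≡_; refl)
open import Relation.Binary.Construct.Closure.ReflexiveTransitive using (Star)
open import Function.Bundles using (Bijection)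

record Graph : Set₁ where
  field
    Vertex : Set
    Edge   : Set
    ends   : Edge → Vertex × Vertex
open Graph public

-- N(G): functions f : V → ℤ with |f u - f v| ≤ 1 on every edge such that
-- the edges with |f u - f v| = 1 form a connected spanning subgraph,
-- taken modulo adding a common constant.

module _ (G : Graph) where

  dist : (Vertex G → ℤ) → Edge G → ℕ
  dist f e = ∣ f (proj₁ (ends G e)) - f (proj₂ (ends G e)) ∣

  TightAdj : (Vertex G → ℤ) → Vertex G → Vertex G → Set
  TightAdj f u v = Σ (Edge G) λ e → dist f e ≡ 1 ×
    ((ends G e ≡ (u , v)) ⊎ (ends G e ≡ (v , u)))

  IsValid : (Vertex G → ℤ) → Set
  IsValid f = (∀ e → dist f e ℕ.≤ 1) ×
              (∀ u v → Star (TightAdj f) u v)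

  _∼_ : (Vertex G → ℤ) → (Vertex G → ℤ) → Set
  f ∼ g = Σ ℤ λ c → ∀ v → f v ≡ g v ℤ.+ c

  ∼-refl : ∀ {f} → f ∼ f
  ∼-refl {f} = ℤ.0ℤ , λ v → ≡.sym (ℤP.+-identityʳ (f v))

  ∼-sym : ∀ {f g} → f ∼ g → g ∼ f
  ∼-sym {f} {g} (c , p) = ℤ.- c , λ v → ≡.sym (begin
      f v ℤ.+ ℤ.- c          ≡⟨ ≡.cong (ℤ._+ ℤ.- c) (p v) ⟩
      g v ℤ.+ c ℤ.+ ℤ.- c    ≡⟨ ℤP.+-assoc (g v) c (ℤ.- c) ⟩
      g v ℤ.+ (c ℤ.+ ℤ.- c)  ≡⟨ ≡.cong (λ z → g v ℤ.+ z) (ℤP.+-inverseʳ c) ⟩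
      g v ℤ.+ ℤ.0ℤ           ≡⟨ ℤP.+-identityʳ (g v) ⟩
      g v ∎)
    where open ≡.≡-Reasoning

  ∼-trans : ∀ {f g h} → f ∼ g → g ∼ h → f ∼ h
  ∼-trans {f} {g} {h} (c , p) (d , q) = d ℤ.+ c , λ v → begin
      f v                   ≡⟨ p v ⟩
      g v ℤ.+ c             ≡⟨ ≡.cong (ℤ._+ c) (q v) ⟩
      h v ℤ.+ d ℤ.+ c       ≡⟨ ℤP.+-assoc (h v) d c ⟩
      h v ℤ.+ (d ℤ.+ c)     ∎
    where open ≡.≡-Reasoning

  HeightSetoid : Setoid 0ℓ 0ℓ
  HeightSetoid = record
    { Carrier = Σ (Vertex G → ℤ) IsValid
    ; _≈_ = λ a b → proj₁ a ∼ proj₁ b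
    ; isEquivalence = record
      { refl = λ {a} → ∼-refl {proj₁ a}
      ; sym = λ {a} {b} → ∼-sym {proj₁ a} {proj₁ b}
      ; trans = λ {a} {b} {c} → ∼-trans {proj₁ a} {proj₁ b} {proj₁ c} } }

  -- "N(G) = k": the classes are in bijection with Fin k.
  HasN : ℕ → Set
  HasN k = Bijection HeightSetoid (≡.setoid (Fin k))

-- k-th vertex (0 ≤ k ≤ x) along a path of length x from s to t whose
-- internal vertices are Fin (x ∸ 1).
pathVertex : {B : Set} (s t : B) (x : ℕ) → ℕ → B ⊎ Fin (x ∸ 1)
pathVertex s t x zero = inj₁ s
pathVertex s t x (suc k) with k <? x ∸ 1
... | yes p = inj₂ (fromℕ< p)
... | no _  = inj₁ t

-- Base vertex type B, m paths, the i-th of length len i from s i to t i,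
-- pairwise internally vertex-disjoint.
PathGlue : (B : Set) (m : ℕ) (len : Fin m → ℕ) (s t : Fin m → B) → Graph
PathGlue B m len s t = record
  { Vertex = B ⊎ Σ (Fin m) (λ i → Fin (len i ∸ 1))
  ; Edge   = Σ (Fin m) (λ i → Fin (len i))
  ; ends   = λ { (i , j) → lift i (pathVertex (s i) (t i) (len i) (toℕ j))
                         , lift i (pathVertex (s i) (t i) (len i) (suc (toℕ j))) }
  }
  where
  lift : (i : Fin m) → B ⊎ Fin (len i ∸ 1) → B ⊎ Σ (Fin m) (λ i → Fin (len i ∸ 1))
  lift i (inj₁ b) = inj₁ b
  lift i (inj₂ k) = inj₂ (i , k)

-- CB(x₁,x₂,x₃): two distinct vertices (false, true) joined by three
-- internally disjoint paths of lengths x₁, x₂, x₃.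
CB : ℕ → ℕ → ℕ → Graph
CB x₁ x₂ x₃ = PathGlue Bool 3 len (λ _ → false) (λ _ → true)
  where
  len : Fin 3 → ℕ
  len Fin.zero = x₁
  len (Fin.suc Fin.zero) = x₂
  len (Fin.suc (Fin.suc Fin.zero)) = x₃

-- The cycle C_m (closed path of length m through a base vertex);
-- C_2 has two parallel edges.
Cycle : ℕ → Graph
Cycle m = PathGlue ⊤ 1 (λ _ → m) (λ _ → tt) (λ _ → tt)

-- C_a ∨ C_b: two cycles sharing one vertex.
Wedge : ℕ → ℕ → Graph
Wedge a b = PathGlue ⊤ 2 len (λ _ → tt) (λ _ → tt)
  where
  len : Fin 2 → ℕ
  len Fin.zero = a
  len (Fin.suc Fin.zero) = b

sumTo : ℕ → (ℕ → ℕ) → ℕ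
sumTo zero g = g 0
sumTo (suc n) g = sumTo n g ℕ.+ g (suc n)

sort3 : ℕ → ℕ → ℕ → ℕ × ℕ × ℕ
sort3 x y z =
  if y ≤ᵇ x
  then (if z ≤ᵇ y then (x , y , z)
        else if z ≤ᵇ x then (x , z , y) else (z , x , y))
  else (if z ≤ᵇ x then (y , x , z)
        else if z ≤ᵇ y then (y , z , x) else (z , y , x))

F′ : ℕ → ℕ → ℕ → ℕ
F′ a b c = sumTo c λ j →
  (c C j) ℕ.* (b C ((b ∸ c) ℕ./ 2 ℕ.+ j)) ℕ.* (a C ((a ∸ c) ℕ./ 2 ℕ.+ j))

F : ℕ → ℕ → ℕ → ℕ
F x y z with sort3 x y z
... | (a , b , c) = F′ a b c

Even Odd : ℕ → Set
Even n = n ℕ.% 2 ≡ 0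
Odd  n = n ℕ.% 2 ≡ 1

-- A valid function on a graph glued from paths is determined, up to a constant, by
-- its values at the branch vertices and its steps f(v_{k+1}) − f(v_k) ∈ {−1, 0, 1}
-- along each path. Validity means: every path has at most one flat step (two would
-- isolate the vertices between them), paths with the same ends have the same total
-- rise, and in CB(x₁,x₂,x₃) some path has no flat step (otherwise the two branch
-- vertices are separated). Deleting the flat steps leaves three ±1-words of lengths
-- xᵢ or xᵢ − 1 with equal sums. Such triples exist only when the lengths have equal
-- parity, and for lengths a ≥ b ≥ c they number F(a,b,c): a word of length c with j
-- up-steps forces (a−c)/2 + j and (b−c)/2 + j up-steps in the other two. Each formula
-- is the resulting sum over which paths carry a flat step, and where; C_a ∨ C_b and
-- C_a are handled in the same way, a loop being a path balanced against an empty word.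

module Submission where

open import Defs
open import Data.Nat using (ℕ; _≤_; _*_; _+_; _∸_)
open import Data.Product using (Σ; _×_)
open import Data.Sum using (_⊎_)

open import Algebra.Bundles using (AbelianGroup)
open import Axiom.UniquenessOfIdentityProofs.WithK using (uip)
open import Data.Bool using (Bool; true; false; T; not; _∧_)
open import Data.Bool.Properties using (∧-zeroʳ)
open import Data.Empty using (⊥-elim)
open import Data.Fin as Fin using (Fin; toℕ; fromℕ<)
open import Data.Fin.Patterns using (0F; 1F; 2F)
open import Data.Fin.Permutation using (↔⇒≡)
import Data.Fin.Properties as FinP
open import Data.Integer as ℤ using (ℤ; +_; -[1+_]; ∣_∣)
import Data.Integer.Properties as ℤP
import Data.Integer.Tactic.RingSolver as ℤ-Ring
open import Data.Nat using (zero; suc; _<_; _≤?_; _<?_; _≤ᵇ_; z≤n; s≤s; _%_; _/_)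
import Data.Nat.Properties as ℕP
open import Data.Nat.Combinatorics using (_C_; nCk+nC[k+1]≡[n+1]C[k+1])
open import Data.Nat.DivMod using (m*n/n≡m; m*[n/m]≡n; [m+kn]%n≡m%n)
open import Data.Nat.Divisibility using (m%n≡0⇒n∣m)
open import Data.Nat.Tactic.RingSolver using (solve-∀)
open import Data.Product using (∃; _,_; proj₁; proj₂; uncurry)
open import Data.Product.Function.NonDependent.Propositional using (_×-↔_)
open import Data.Sum using (inj₁; inj₂; [_,_]′)
open import Data.Sum.Function.Propositional using (_⊎-↔_)
open import Data.Unit using (⊤; tt)
open import Data.Vec using (Vec; []; _∷_; map)
open import Function.Bundles using (_↔_; mk↔ₛ′; Inverse)
open import Function.Properties.Inverse using (↔-refl; ↔-sym; ↔-trans)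
open import Relation.Binary.Construct.Closure.ReflexiveTransitive using (Star; ε; _◅_; _◅◅_; fold; reverse)
open import Relation.Binary.PropositionalEquality
open import Relation.Nullary using (¬_; yes; no; Irrelevant)
open import Algebra.Properties.Group (AbelianGroup.group ℤP.+-0-abelianGroup) using (∙-cancelˡ; ∙-cancelʳ)

-- Counting through explicit bijections

Card : Set → ℕ → Set
Card A n = A ↔ Fin n

infixr 4 _⨾_
_⨾_ : {A B C : Set} → A ↔ B → B ↔ C → A ↔ C
_⨾_ = ↔-trans

card-⊎ : {A B : Set} {m n : ℕ} → Card A m → Card B n → Card (A ⊎ B) (m + n)
card-⊎ a b = (a ⊎-↔ b) ⨾ ↔-sym FinP.+↔⊎

card-× : {A B : Set} {m n : ℕ} → Card A m → Card B n → Card (A × B) (m * n)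
card-× a b = (a ×-↔ b) ⨾ ↔-sym FinP.*↔×

card-⊤ : Card ⊤ 1
card-⊤ = ↔-sym FinP.1↔⊤

card-empty : {A : Set} → ¬ A → Card A 0
card-empty ¬a = mk↔ₛ′ (λ a → ⊥-elim (¬a a)) (λ ()) (λ ()) (λ a → ⊥-elim (¬a a))

Σ-Bool↔⊎ : (P : Bool → Set) → Σ Bool P ↔ (P false ⊎ P true)
Σ-Bool↔⊎ P = mk↔ₛ′
  (λ { (false , p) → inj₁ p ; (true , p) → inj₂ p })
  (λ { (inj₁ p) → false , p ; (inj₂ p) → true , p })
  (λ { (inj₁ p) → refl ; (inj₂ p) → refl })
  (λ { (false , p) → refl ; (true , p) → refl })

prop×↔ : {A B : Set} → A → Irrelevant A → (A × B) ↔ B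
prop×↔ a irr = mk↔ₛ′ proj₂ (a ,_) (λ _ → refl) (λ { (a′ , b) → cong (_, b) (irr a a′) })

≡×≡-irrelevant : {A : Set} {a b c d : A} → Irrelevant (a ≡ b × c ≡ d)
≡×≡-irrelevant (p , p′) (q , q′) = cong₂ _,_ (uip p q) (uip p′ q′)

Σ-↔-prop : {A B : Set} {P : A → Set} {Q : B → Set} (i : A ↔ B) →
  (∀ {a} → P a → Q (Inverse.to i a)) → (∀ {b} → Q b → P (Inverse.from i b)) →
  (∀ {a} → Irrelevant (P a)) → (∀ {b} → Irrelevant (Q b)) → Σ A P ↔ Σ B Q
Σ-↔-prop {P = P} {Q} i P⇒Q Q⇒P P-irr Q-irr = mk↔ₛ′
  (λ { (a , p) → Inverse.to i a , P⇒Q p })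
  (λ { (b , q) → Inverse.from i b , Q⇒P q })
  (λ { (b , q) → Σ-≡ Q Q-irr (Inverse.strictlyInverseˡ i b) })
  (λ { (a , p) → Σ-≡ P P-irr (Inverse.strictlyInverseʳ i a) })
  where
  Σ-≡ : {X : Set} (R : X → Set) → (∀ {x} → Irrelevant (R x)) →
        {x y : X} {r : R x} {r′ : R y} → x ≡ y → (x , r) ≡ (y , r′)
  Σ-≡ R R-irr refl = cong (_ ,_) (R-irr _ _)

trues : ∀ {n} → Vec Bool n → ℕ
trues [] = 0
trues (true ∷ v) = suc (trues v)
trues (false ∷ v) = trues v

Trues : ℕ → ℕ → Set
Trues n k = Σ (Vec Bool n) (λ v → trues v ≡ k)

Trues-suc-zero↔ : ∀ n → Trues (suc n) zero ↔ Trues n zero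
Trues-suc-zero↔ n = mk↔ₛ′
  (λ { (false ∷ v , e) → v , e ; (true ∷ v , ()) })
  (λ { (v , e) → false ∷ v , e })
  (λ _ → refl)
  (λ { (false ∷ v , e) → refl ; (true ∷ v , ()) })

Trues-suc-suc↔ : ∀ n k → Trues (suc n) (suc k) ↔ (Trues n k ⊎ Trues n (suc k))
Trues-suc-suc↔ n k = mk↔ₛ′
  (λ { (true ∷ v , e) → inj₁ (v , ℕP.suc-injective e) ; (false ∷ v , e) → inj₂ (v , e) })
  (λ { (inj₁ (v , e)) → true ∷ v , cong suc e ; (inj₂ (v , e)) → false ∷ v , e })
  (λ { (inj₁ (v , e)) → cong (λ q → inj₁ (v , q)) (uip _ _) ; (inj₂ (v , e)) → refl })
  (λ { (true ∷ v , e) → cong (λ q → true ∷ v , q) (uip _ _) ; (false ∷ v , e) → refl })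

card-Trues : ∀ n k → Card (Trues n k) (n C k)
card-Trues zero zero = mk↔ₛ′ (λ _ → tt) (λ _ → [] , refl) (λ _ → refl) (λ { ([] , refl) → refl }) ⨾ card-⊤
card-Trues zero (suc k) = card-empty λ { ([] , ()) }
card-Trues (suc n) zero = Trues-suc-zero↔ n ⨾ card-Trues n zero
card-Trues (suc n) (suc k) = subst (Card _) (nCk+nC[k+1]≡[n+1]C[k+1] n k)
  (Trues-suc-suc↔ n k ⨾ card-⊎ (card-Trues n k) (card-Trues n (suc k)))

Σ≤ : ℕ → (ℕ → Set) → Set
Σ≤ c A = Σ ℕ (λ p → p ≤ c × A p)

Σ≤-suc↔ : ∀ c (A : ℕ → Set) → Σ≤ (suc c) A ↔ (Σ≤ c A ⊎ A (suc c))
Σ≤-suc↔ c A = mk↔ₛ′ to from to-from from-to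
  where
  to : Σ≤ (suc c) A → Σ≤ c A ⊎ A (suc c)
  to (p , p≤1+c , a) with p ≤? c
  ... | yes p≤c = inj₁ (p , p≤c , a)
  ... | no p≰c with ℕP.≤-antisym p≤1+c (ℕP.≰⇒> p≰c)
  ...   | refl = inj₂ a
  from : Σ≤ c A ⊎ A (suc c) → Σ≤ (suc c) A
  from (inj₁ (p , p≤c , a)) = p , ℕP.m≤n⇒m≤1+n p≤c , a
  from (inj₂ a) = suc c , ℕP.≤-refl , a
  to-from : ∀ x → to (from x) ≡ x
  to-from (inj₁ (p , p≤c , a)) with p ≤? c
  ... | yes p≤c′ = cong (λ q → inj₁ (p , q , a)) (ℕP.≤-irrelevant p≤c′ p≤c)
  ... | no p≰c = ⊥-elim (p≰c p≤c)
  to-from (inj₂ a) with suc c ≤? c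
  ... | yes 1+c≤c = ⊥-elim (ℕP.<-irrefl refl 1+c≤c)
  ... | no 1+c≰c with ℕP.≤-antisym (ℕP.≤-refl {suc c}) (ℕP.≰⇒> 1+c≰c)
  ...   | e rewrite uip e refl = refl
  from-to : ∀ x → from (to x) ≡ x
  from-to (p , p≤1+c , a) with p ≤? c
  ... | yes _ = cong (λ q → p , q , a) (ℕP.≤-irrelevant _ _)
  ... | no p≰c with ℕP.≤-antisym p≤1+c (ℕP.≰⇒> p≰c)
  ...   | refl = cong (λ q → suc c , q , a) (ℕP.≤-irrelevant _ _)

card-Σ≤ : ∀ c {A : ℕ → Set} {g : ℕ → ℕ} → (∀ p → Card (A p) (g p)) → Card (Σ≤ c A) (sumTo c g)
card-Σ≤ zero h = mk↔ₛ′ (λ { (.0 , z≤n , a) → a }) (λ a → 0 , z≤n , a)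
  (λ _ → refl) (λ { (.0 , z≤n , a) → refl }) ⨾ h 0
card-Σ≤ (suc c) {A} h = Σ≤-suc↔ c A ⨾ card-⊎ (card-Σ≤ c h) (h (suc c))

-- Triples of ±1-words ending at the same height

-- A ±1-word of length y with u up-steps ends at height 2u − y, so two words
-- end at the same height iff the following holds (stated without subtraction).
SameEnd : ℕ × ℕ → ℕ × ℕ → Set
SameEnd (u , y) (u′ , y′) = 2 * u + y′ ≡ 2 * u′ + y

SameEnd-trans : ∀ a b c → SameEnd a b → SameEnd b c → SameEnd a c
SameEnd-trans (u₁ , y₁) (u₂ , y₂) (u₃ , y₃) e₁ e₂ = ℕP.+-cancelʳ-≡ (2 * u₂ + y₂) _ _ (begin
    2 * u₁ + y₃ + (2 * u₂ + y₂)   ≡⟨ shuffle u₁ y₃ u₂ y₂ ⟩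
    2 * u₁ + y₂ + (2 * u₂ + y₃)   ≡⟨ cong₂ _+_ e₁ e₂ ⟩
    2 * u₂ + y₁ + (2 * u₃ + y₂)   ≡⟨ shuffle′ u₂ y₁ u₃ y₂ ⟩
    2 * u₃ + y₁ + (2 * u₂ + y₂)   ∎)
  where
  open ≡-Reasoning
  shuffle : ∀ a b c d → 2 * a + b + (2 * c + d) ≡ 2 * a + d + (2 * c + b)
  shuffle = solve-∀
  shuffle′ : ∀ a b c d → 2 * a + b + (2 * c + d) ≡ 2 * c + b + (2 * a + d)
  shuffle′ = solve-∀

endpoint : ∀ {n} → Vec Bool n → ℕ × ℕ
endpoint {n} v = trues v , n

Balanced3 : ℕ → ℕ → ℕ → Set
Balanced3 y₁ y₂ y₃ = Σ (Vec Bool y₁ × Vec Bool y₂ × Vec Bool y₃) λ { (v₁ , v₂ , v₃) →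
  SameEnd (endpoint v₁) (endpoint v₂) × SameEnd (endpoint v₂) (endpoint v₃) }

Balanced3-swap₁₂ : ∀ x y z → Balanced3 x y z ↔ Balanced3 y x z
Balanced3-swap₁₂ x y z = Σ-↔-prop (mk↔ₛ′ swap swap (λ _ → refl) (λ _ → refl))
  (λ { {v₁ , v₂ , v₃} (e₁ , e₂) → sym e₁ , SameEnd-trans (endpoint v₁) (endpoint v₂) (endpoint v₃) e₁ e₂ })
  (λ { {v₂ , v₁ , v₃} (e₁ , e₂) → sym e₁ , SameEnd-trans (endpoint v₂) (endpoint v₁) (endpoint v₃) e₁ e₂ })
  ≡×≡-irrelevant ≡×≡-irrelevant
  where
  swap : ∀ {A B C : Set} → A × B × C → B × A × C
  swap (a , b , c) = b , a , c

Balanced3-swap₂₃ : ∀ x y z → Balanced3 x y z ↔ Balanced3 x z y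
Balanced3-swap₂₃ x y z = Σ-↔-prop (mk↔ₛ′ swap swap (λ _ → refl) (λ _ → refl))
  (λ { {v₁ , v₂ , v₃} (e₁ , e₂) → SameEnd-trans (endpoint v₁) (endpoint v₂) (endpoint v₃) e₁ e₂ , sym e₂ })
  (λ { {v₁ , v₃ , v₂} (e₁ , e₂) → SameEnd-trans (endpoint v₁) (endpoint v₃) (endpoint v₂) e₁ e₂ , sym e₂ })
  ≡×≡-irrelevant ≡×≡-irrelevant
  where
  swap : ∀ {A B C : Set} → A × B × C → A × C × B
  swap (a , b , c) = a , c , b

SameEnd-lift : ∀ u u′ y β → u ≡ β + u′ → SameEnd (u , y + 2 * β) (u′ , y)
SameEnd-lift .(β + u′) u′ y β refl = rearrange β u′ y
  where
  rearrange : ∀ β u′ y → 2 * (β + u′) + y ≡ 2 * u′ + (y + 2 * β)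
  rearrange = solve-∀

SameEnd-drop : ∀ u u′ y β → SameEnd (u , y + 2 * β) (u′ , y) → u ≡ β + u′
SameEnd-drop u u′ y β e = ℕP.*-cancelˡ-≡ u (β + u′) 2 (ℕP.+-cancelʳ-≡ y _ _
  (trans e (sym (SameEnd-lift (β + u′) u′ y β refl))))

trues≤length : ∀ {n} (v : Vec Bool n) → trues v ≤ n
trues≤length [] = z≤n
trues≤length (true ∷ v) = s≤s (trues≤length v)
trues≤length (false ∷ v) = ℕP.m≤n⇒m≤1+n (trues≤length v)

-- Fixing the number p of up-steps in the shortest word fixes it in the other two.
Balanced3-shifted↔ : ∀ c α β → Balanced3 (c + 2 * α) (c + 2 * β) c ↔
  Σ≤ c (λ p → (Trues c p × Trues (c + 2 * β) (β + p)) × Trues (c + 2 * α) (α + p))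
Balanced3-shifted↔ c α β = mk↔ₛ′ to from to-from from-to
  where
  Shifted = Σ≤ c (λ p → (Trues c p × Trues (c + 2 * β) (β + p)) × Trues (c + 2 * α) (α + p))
  to : Balanced3 (c + 2 * α) (c + 2 * β) c → Shifted
  to ((v₁ , v₂ , v₃) , e₁₂ , e₂₃) = trues v₃ , trues≤length v₃ ,
    ((v₃ , refl) , (v₂ , SameEnd-drop _ _ c β e₂₃)) ,
    (v₁ , SameEnd-drop _ _ c α (SameEnd-trans (endpoint v₁) (endpoint v₂) (endpoint v₃) e₁₂ e₂₃))
  from : Shifted → Balanced3 (c + 2 * α) (c + 2 * β) c
  from (p , _ , ((v₃ , refl) , (v₂ , e₂)) , (v₁ , e₁)) = (v₁ , v₂ , v₃) ,
    SameEnd-trans (trues v₁ , c + 2 * α) (p , c) (endpoint v₂) (SameEnd-lift _ _ c α e₁) (sym e₂₃) , e₂₃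
    where e₂₃ = SameEnd-lift _ _ c β e₂
  to-from : ∀ x → to (from x) ≡ x
  to-from (p , _ , ((v₃ , refl) , (v₂ , e₂)) , (v₁ , e₁)) =
    cong₂ (λ r s → p , r , ((v₃ , refl) , (v₂ , proj₁ s)) , (v₁ , proj₂ s))
      (ℕP.≤-irrelevant _ _) (≡×≡-irrelevant _ _)
  from-to : ∀ x → from (to x) ≡ x
  from-to ((v₁ , v₂ , v₃) , e) = cong ((v₁ , v₂ , v₃) ,_) (≡×≡-irrelevant _ _)

SameParity : ℕ → ℕ → Set
SameParity x y = x % 2 ≡ y % 2

gap-even : ∀ c d → SameParity (c + d) c → d % 2 ≡ 0
gap-even zero d e = e
gap-even (suc zero) zero e = refl
gap-even (suc zero) (suc zero) ()
gap-even (suc zero) (suc (suc d)) e = gap-even 1 d e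
gap-even (suc (suc c)) d e = gap-even c d e

parity-gap : ∀ {a c} → c ≤ a → SameParity a c → a ≡ c + 2 * ((a ∸ c) / 2)
parity-gap {a} {c} c≤a e = begin
    a                          ≡⟨ ℕP.m+[n∸m]≡n c≤a ⟨
    c + (a ∸ c)                ≡⟨ cong (λ k → c + k) (m*[n/m]≡n (m%n≡0⇒n∣m (a ∸ c) 2 (gap-even c (a ∸ c) e′))) ⟨
    c + 2 * ((a ∸ c) / 2)      ∎
  where
  open ≡-Reasoning
  e′ : SameParity (c + (a ∸ c)) c
  e′ = trans (cong (_% 2) (ℕP.m+[n∸m]≡n c≤a)) e

half-gap : ∀ c α → (c + 2 * α ∸ c) / 2 ≡ α
half-gap c α = trans (cong (_/ 2) (ℕP.m+n∸m≡n c (2 * α))) (trans (cong (_/ 2) (ℕP.*-comm 2 α)) (m*n/n≡m α 2))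

sumTo-cong : ∀ c {f g : ℕ → ℕ} → (∀ j → f j ≡ g j) → sumTo c f ≡ sumTo c g
sumTo-cong zero f≗g = f≗g 0
sumTo-cong (suc c) f≗g = cong₂ _+_ (sumTo-cong c f≗g) (f≗g (suc c))

card-Balanced3-sorted : ∀ a b c → c ≤ a → c ≤ b → SameParity a c → SameParity b c →
  Card (Balanced3 a b c) (F′ a b c)
card-Balanced3-sorted a b c c≤a c≤b pa pb
  rewrite parity-gap c≤a pa | parity-gap c≤b pb
  = subst (Card _) (sumTo-cong c λ j → sym (cong₂ (λ p q → (c C j) * ((c + 2 * β) C (p + j)) * ((c + 2 * α) C (q + j)))
        (half-gap c β) (half-gap c α)))
      (Balanced3-shifted↔ c α β ⨾ card-Σ≤ c λ p →
        card-× (card-× (card-Trues c p) (card-Trues (c + 2 * β) (β + p))) (card-Trues (c + 2 * α) (α + p)))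
  where
  α = (a ∸ c) / 2
  β = (b ∸ c) / 2

F-sort3 : ∀ x y z → F x y z ≡ F′ (proj₁ (sort3 x y z)) (proj₁ (proj₂ (sort3 x y z))) (proj₂ (proj₂ (sort3 x y z)))
F-sort3 x y z with sort3 x y z
... | (a , b , c) = refl

card-Balanced3 : ∀ x y z → SameParity x y → SameParity y z → Card (Balanced3 x y z) (F x y z)
card-Balanced3 x y z pxy pyz = subst (Card _) (sym (F-sort3 x y z))
  (by-order (y ≤ᵇ x) refl (z ≤ᵇ y) refl (z ≤ᵇ x) refl)
  where
  pxz = trans pxy pyz
  ≤ᵇ-true : ∀ {m n} → (m ≤ᵇ n) ≡ true → m ≤ n
  ≤ᵇ-true {m} {n} e = ℕP.≤ᵇ⇒≤ m n (subst T (sym e) tt)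
  ≤ᵇ-false : ∀ {m n} → (m ≤ᵇ n) ≡ false → n ≤ m
  ≤ᵇ-false e = ℕP.<⇒≤ (ℕP.≰⇒> λ m≤n → subst T e (ℕP.≤⇒≤ᵇ m≤n))
  by-order : ∀ b₁ → (y ≤ᵇ x) ≡ b₁ → ∀ b₂ → (z ≤ᵇ y) ≡ b₂ → ∀ b₃ → (z ≤ᵇ x) ≡ b₃ →
    Card (Balanced3 x y z) (F′ (proj₁ (sort3 x y z)) (proj₁ (proj₂ (sort3 x y z))) (proj₂ (proj₂ (sort3 x y z))))
  by-order true y≤x true z≤y _ _ rewrite y≤x | z≤y =
    card-Balanced3-sorted x y z (ℕP.≤-trans (≤ᵇ-true z≤y) (≤ᵇ-true y≤x)) (≤ᵇ-true z≤y) pxz pyz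
  by-order true y≤x false y≤z true z≤x rewrite y≤x | y≤z | z≤x =
    Balanced3-swap₂₃ x y z ⨾ card-Balanced3-sorted x z y (≤ᵇ-true y≤x) (≤ᵇ-false y≤z) pxy (sym pyz)
  by-order true y≤x false y≤z false x≤z rewrite y≤x | y≤z | x≤z =
    Balanced3-swap₂₃ x y z ⨾ Balanced3-swap₁₂ x z y ⨾
      card-Balanced3-sorted z x y (≤ᵇ-false y≤z) (≤ᵇ-true y≤x) (sym pyz) pxy
  by-order false x≤y _ _ true z≤x rewrite x≤y | z≤x =
    Balanced3-swap₁₂ x y z ⨾ card-Balanced3-sorted y x z (ℕP.≤-trans (≤ᵇ-true z≤x) (≤ᵇ-false x≤y)) (≤ᵇ-true z≤x) pyz pxz
  by-order false x≤y true z≤y false x≤z rewrite x≤y | z≤y | x≤z =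
    Balanced3-swap₁₂ x y z ⨾ Balanced3-swap₂₃ y x z ⨾
      card-Balanced3-sorted y z x (≤ᵇ-false x≤y) (≤ᵇ-false x≤z) (sym pxy) (sym pxz)
  by-order false x≤y false y≤z false x≤z rewrite x≤y | y≤z | x≤z =
    Balanced3-swap₁₂ x y z ⨾ Balanced3-swap₂₃ y x z ⨾ Balanced3-swap₁₂ y z x ⨾
      card-Balanced3-sorted z y x (≤ᵇ-false x≤z) (≤ᵇ-false x≤y) (sym pxz) (sym pxy)

SameEnd⇒SameParity : ∀ a b → SameEnd a b → SameParity (proj₂ a) (proj₂ b)
SameEnd⇒SameParity (u , y) (u′ , y′) e = sym (begin
    y′ % 2              ≡⟨ drop-double u y′ ⟨
    (2 * u + y′) % 2    ≡⟨ cong (_% 2) e ⟩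
    (2 * u′ + y) % 2    ≡⟨ drop-double u′ y ⟩
    y % 2               ∎)
  where
  open ≡-Reasoning
  drop-double : ∀ u y → (2 * u + y) % 2 ≡ y % 2
  drop-double u y = trans (cong (_% 2) (ℕP.+-comm (2 * u) y))
    (trans (cong (λ k → (y + k) % 2) (ℕP.*-comm 2 u)) ([m+kn]%n≡m%n y u 2))

Balanced3-empty₁₂ : ∀ x y z → ¬ SameParity x y → Card (Balanced3 x y z) 0
Balanced3-empty₁₂ x y z ¬p = card-empty λ { ((v₁ , v₂ , _) , e , _) → ¬p (SameEnd⇒SameParity (endpoint v₁) (endpoint v₂) e) }

Balanced3-empty₂₃ : ∀ x y z → ¬ SameParity y z → Card (Balanced3 x y z) 0
Balanced3-empty₂₃ x y z ¬p = card-empty λ { ((_ , v₂ , v₃) , _ , e) → ¬p (SameEnd⇒SameParity (endpoint v₂) (endpoint v₃) e) }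

-- Step words

data Step : Set where
  down flat up : Step

rise : Step → ℤ
rise down = -[1+ 0 ]
rise flat = + 0
rise up = + 1

totalRise : ∀ {n} → Vec Step n → ℤ
totalRise [] = + 0
totalRise (s ∷ w) = rise s ℤ.+ totalRise w

flats : ∀ {n} → Vec Step n → ℕ
flats [] = 0
flats (flat ∷ w) = suc (flats w)
flats (down ∷ w) = flats w
flats (up ∷ w) = flats w

fromBool : Bool → Step
fromBool true = up
fromBool false = down

isUp : Step → Bool
isUp up = true
isUp _ = false

toBools : ∀ {n} → Vec Step n → Vec Bool n
toBools = map isUp

boolRise : ∀ {n} → Vec Bool n → ℤ
boolRise v = totalRise (map fromBool v)

boolRise-trues : ∀ {n} (v : Vec Bool n) → boolRise v ℤ.+ + n ≡ + (2 * trues v)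
boolRise-trues [] = refl
boolRise-trues {suc n} (true ∷ v) = begin
    + 1 ℤ.+ boolRise v ℤ.+ + suc n    ≡⟨ shuffle (boolRise v) (+ n) ⟩
    boolRise v ℤ.+ + n ℤ.+ + 2        ≡⟨ cong (ℤ._+ + 2) (boolRise-trues v) ⟩
    + (2 * trues v) ℤ.+ + 2           ≡⟨ cong +_ (ℕP.+-comm (2 * trues v) 2) ⟩
    + (2 + 2 * trues v)               ≡⟨ cong +_ (ℕP.*-distribˡ-+ 2 1 (trues v)) ⟨
    + (2 * suc (trues v))             ∎
  where
  open ≡-Reasoning
  shuffle : ∀ b m → + 1 ℤ.+ b ℤ.+ (+ 1 ℤ.+ m) ≡ b ℤ.+ m ℤ.+ + 2
  shuffle = ℤ-Ring.solve-∀
boolRise-trues {suc n} (false ∷ v) = trans (shuffle (boolRise v) (+ n)) (boolRise-trues v)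
  where
  shuffle : ∀ b m → -[1+ 0 ] ℤ.+ b ℤ.+ (+ 1 ℤ.+ m) ≡ b ℤ.+ m
  shuffle = ℤ-Ring.solve-∀

boolRise-shift : ∀ {n₁} (v₁ : Vec Bool n₁) n₂ →
  boolRise v₁ ℤ.+ (+ n₁ ℤ.+ + n₂) ≡ + (2 * trues v₁ + n₂)
boolRise-shift {n₁} v₁ n₂ = begin
    boolRise v₁ ℤ.+ (+ n₁ ℤ.+ + n₂)   ≡⟨ ℤP.+-assoc (boolRise v₁) (+ n₁) (+ n₂) ⟨
    boolRise v₁ ℤ.+ + n₁ ℤ.+ + n₂     ≡⟨ cong (ℤ._+ + n₂) (boolRise-trues v₁) ⟩
    + (2 * trues v₁) ℤ.+ + n₂         ≡⟨ ℤP.pos-+ (2 * trues v₁) n₂ ⟨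
    + (2 * trues v₁ + n₂)             ∎
  where open ≡-Reasoning

boolRise≡⇒SameEnd : ∀ {n₁ n₂} (v₁ : Vec Bool n₁) (v₂ : Vec Bool n₂) →
  boolRise v₁ ≡ boolRise v₂ → SameEnd (endpoint v₁) (endpoint v₂)
boolRise≡⇒SameEnd {n₁} {n₂} v₁ v₂ e = ℤP.+-injective (begin
    + (2 * trues v₁ + n₂)              ≡⟨ boolRise-shift v₁ n₂ ⟨
    boolRise v₁ ℤ.+ (+ n₁ ℤ.+ + n₂)    ≡⟨ cong₂ ℤ._+_ e (ℤP.+-comm (+ n₁) (+ n₂)) ⟩
    boolRise v₂ ℤ.+ (+ n₂ ℤ.+ + n₁)    ≡⟨ boolRise-shift v₂ n₁ ⟩
    + (2 * trues v₂ + n₁)              ∎)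
  where open ≡-Reasoning

SameEnd⇒boolRise≡ : ∀ {n₁ n₂} (v₁ : Vec Bool n₁) (v₂ : Vec Bool n₂) →
  SameEnd (endpoint v₁) (endpoint v₂) → boolRise v₁ ≡ boolRise v₂
SameEnd⇒boolRise≡ {n₁} {n₂} v₁ v₂ e = ∙-cancelʳ (+ n₁ ℤ.+ + n₂) _ _ (begin
    boolRise v₁ ℤ.+ (+ n₁ ℤ.+ + n₂)    ≡⟨ boolRise-shift v₁ n₂ ⟩
    + (2 * trues v₁ + n₂)              ≡⟨ cong +_ e ⟩
    + (2 * trues v₂ + n₁)              ≡⟨ boolRise-shift v₂ n₁ ⟨
    boolRise v₂ ℤ.+ (+ n₂ ℤ.+ + n₁)    ≡⟨ cong (λ k → boolRise v₂ ℤ.+ k) (ℤP.+-comm (+ n₂) (+ n₁)) ⟩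
    boolRise v₂ ℤ.+ (+ n₁ ℤ.+ + n₂)    ∎)
  where open ≡-Reasoning

FewFlats : ℕ → Set
FewFlats x = Σ (Vec Step x) (λ w → flats w ≤ 1)

flatCount : Bool → ℕ
flatCount false = 0
flatCount true = 1

FlatSpot : ℕ → Bool → Set
FlatSpot x false = ⊤
FlatSpot x true = Fin x

-- A word with at most one flat step: whether it has one, where, and its ±1 steps.
Coded : ℕ → Set
Coded x = Σ Bool (λ b → FlatSpot x b × Vec Bool (x ∸ flatCount b))

decode : ∀ {x} → Coded x → Vec Step x
decode (false , tt , v) = map fromBool v
decode {suc x} (true , Fin.zero , v) = flat ∷ map fromBool v
decode {suc (suc x)} (true , Fin.suc p , c ∷ v) = fromBool c ∷ decode {suc x} (true , p , v)

consCoded : ∀ {x} → Bool → Coded x → Coded (suc x)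
consCoded c (false , tt , v) = false , tt , c ∷ v
consCoded {suc x} c (true , p , v) = true , Fin.suc p , c ∷ v

encode : ∀ {x} → Vec Step x → Coded x
encode [] = false , tt , []
encode (flat ∷ w) = true , Fin.zero , toBools w
encode (s ∷ w) = consCoded (isUp s) (encode w)

toBools-fromBool : ∀ {x} (v : Vec Bool x) → toBools (map fromBool v) ≡ v
toBools-fromBool [] = refl
toBools-fromBool (true ∷ v) = cong (true ∷_) (toBools-fromBool v)
toBools-fromBool (false ∷ v) = cong (false ∷_) (toBools-fromBool v)

fromBool-toBools : ∀ {x} (w : Vec Step x) → flats w ≡ 0 → map fromBool (toBools w) ≡ w
fromBool-toBools [] _ = refl
fromBool-toBools (down ∷ w) e = cong (down ∷_) (fromBool-toBools w e)
fromBool-toBools (up ∷ w) e = cong (up ∷_) (fromBool-toBools w e)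

encode-fromBool : ∀ {x} (v : Vec Bool x) → encode (map fromBool v) ≡ (false , tt , v)
encode-fromBool [] = refl
encode-fromBool (true ∷ v) rewrite encode-fromBool v = refl
encode-fromBool (false ∷ v) rewrite encode-fromBool v = refl

encode-decode : ∀ {x} (c : Coded x) → encode (decode c) ≡ c
encode-decode (false , tt , v) = encode-fromBool v
encode-decode {suc x} (true , Fin.zero , v) = cong (λ u → true , Fin.zero , u) (toBools-fromBool v)
encode-decode {suc (suc x)} (true , Fin.suc p , true ∷ v) rewrite encode-decode {suc x} (true , p , v) = refl
encode-decode {suc (suc x)} (true , Fin.suc p , false ∷ v) rewrite encode-decode {suc x} (true , p , v) = refl

decode-consCoded : ∀ {x} b (c : Coded x) → decode (consCoded b c) ≡ fromBool b ∷ decode c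
decode-consCoded b (false , tt , v) = refl
decode-consCoded {suc x} b (true , p , v) = refl

decode-encode : ∀ {x} (w : Vec Step x) → flats w ≤ 1 → decode (encode w) ≡ w
decode-encode [] _ = refl
decode-encode (flat ∷ w) (s≤s le) = cong (flat ∷_) (fromBool-toBools w (ℕP.n≤0⇒n≡0 le))
decode-encode (down ∷ w) le = trans (decode-consCoded false (encode w)) (cong (down ∷_) (decode-encode w le))
decode-encode (up ∷ w) le = trans (decode-consCoded true (encode w)) (cong (up ∷_) (decode-encode w le))

flats-fromBool : ∀ {x} (v : Vec Bool x) → flats (map fromBool v) ≡ 0
flats-fromBool [] = refl
flats-fromBool (true ∷ v) = flats-fromBool v
flats-fromBool (false ∷ v) = flats-fromBool v

flats-decode : ∀ {x} (c : Coded x) → flats (decode c) ≡ flatCount (proj₁ c)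
flats-decode (false , tt , v) = flats-fromBool v
flats-decode {suc x} (true , Fin.zero , v) = cong suc (flats-fromBool v)
flats-decode {suc (suc x)} (true , Fin.suc p , true ∷ v) = flats-decode {suc x} (true , p , v)
flats-decode {suc (suc x)} (true , Fin.suc p , false ∷ v) = flats-decode {suc x} (true , p , v)

totalRise-decode : ∀ {x} (c : Coded x) → totalRise (decode c) ≡ boolRise (proj₂ (proj₂ c))
totalRise-decode (false , tt , v) = refl
totalRise-decode {suc x} (true , Fin.zero , v) = ℤP.+-identityˡ (boolRise v)
totalRise-decode {suc (suc x)} (true , Fin.suc p , c ∷ v) =
  cong (λ k → rise (fromBool c) ℤ.+ k) (totalRise-decode {suc x} (true , p , v))

flatCount≤1 : ∀ b → flatCount b ≤ 1
flatCount≤1 false = z≤n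
flatCount≤1 true = s≤s z≤n

FewFlats↔Coded : ∀ x → FewFlats x ↔ Coded x
FewFlats↔Coded x = mk↔ₛ′
  (λ { (w , _) → encode w })
  (λ c → decode c , subst (_≤ 1) (sym (flats-decode c)) (flatCount≤1 (proj₁ c)))
  encode-decode
  (λ { (w , le) → Σ-≡ (decode-encode w le) })
  where
  Σ-≡ : {w w′ : Vec Step x} {p : flats w ≤ 1} {q : flats w′ ≤ 1} → w ≡ w′ → (w , p) ≡ (w′ , q)
  Σ-≡ {w} refl = cong (w ,_) (ℕP.≤-irrelevant _ _)

StepTripleCondition : ∀ {x₁ x₂ x₃} → FewFlats x₁ × FewFlats x₂ × FewFlats x₃ → Set
StepTripleCondition ((w₁ , _) , (w₂ , _) , (w₃ , _)) =
  flats w₁ + flats w₂ + flats w₃ ≤ 2 × totalRise w₁ ≡ totalRise w₂ × totalRise w₂ ≡ totalRise w₃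

StepTriple : ℕ → ℕ → ℕ → Set
StepTriple x₁ x₂ x₃ = Σ (FewFlats x₁ × FewFlats x₂ × FewFlats x₃) StepTripleCondition

CodedTripleCondition : ∀ {x₁ x₂ x₃} → Coded x₁ × Coded x₂ × Coded x₃ → Set
CodedTripleCondition ((b₁ , _ , v₁) , (b₂ , _ , v₂) , (b₃ , _ , v₃)) =
  flatCount b₁ + flatCount b₂ + flatCount b₃ ≤ 2 × SameEnd (endpoint v₁) (endpoint v₂) × SameEnd (endpoint v₂) (endpoint v₃)

CodedTriple : ℕ → ℕ → ℕ → Set
CodedTriple x₁ x₂ x₃ = Σ (Coded x₁ × Coded x₂ × Coded x₃) CodedTripleCondition

flats-encode : ∀ {x} (w : Vec Step x) → flats w ≤ 1 → flats w ≡ flatCount (proj₁ (encode w))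
flats-encode w le = trans (cong flats (sym (decode-encode w le))) (flats-decode (encode w))

totalRise-encode : ∀ {x} (w : Vec Step x) → flats w ≤ 1 → totalRise w ≡ boolRise (proj₂ (proj₂ (encode w)))
totalRise-encode w le = trans (cong totalRise (sym (decode-encode w le))) (totalRise-decode (encode w))

≤×≡×≡-irrelevant : {A : Set} {m n : ℕ} {a b c d : A} → Irrelevant (m ≤ n × a ≡ b × c ≡ d)
≤×≡×≡-irrelevant (p , q) (p′ , q′) = cong₂ _,_ (ℕP.≤-irrelevant p p′) (≡×≡-irrelevant q q′)

StepTriple↔CodedTriple : ∀ x₁ x₂ x₃ → StepTriple x₁ x₂ x₃ ↔ CodedTriple x₁ x₂ x₃
StepTriple↔CodedTriple x₁ x₂ x₃ =
  Σ-↔-prop coding (λ {t} → to {t}) (λ {c} → from {c})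
    (λ { {(w₁ , _) , (w₂ , _) , (w₃ , _)} → ≤×≡×≡-irrelevant })
    (λ { {(_ , _ , v₁) , (_ , _ , v₂) , (_ , _ , v₃)} → ≤×≡×≡-irrelevant })
  where
  coding = FewFlats↔Coded x₁ ×-↔ FewFlats↔Coded x₂ ×-↔ FewFlats↔Coded x₃
  to : ∀ {t} → StepTripleCondition t → CodedTripleCondition (Inverse.to coding t)
  to {(w₁ , l₁) , (w₂ , l₂) , (w₃ , l₃)} (s , e₁₂ , e₂₃) =
    subst (_≤ 2) (cong₂ _+_ (cong₂ _+_ (flats-encode w₁ l₁) (flats-encode w₂ l₂)) (flats-encode w₃ l₃)) s ,
    boolRise≡⇒SameEnd (bits w₁) (bits w₂) (trans (sym (totalRise-encode w₁ l₁)) (trans e₁₂ (totalRise-encode w₂ l₂))) ,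
    boolRise≡⇒SameEnd (bits w₂) (bits w₃) (trans (sym (totalRise-encode w₂ l₂)) (trans e₂₃ (totalRise-encode w₃ l₃)))
    where
    bits : ∀ {x} (w : Vec Step x) → Vec Bool (x ∸ flatCount (proj₁ (encode w)))
    bits w = proj₂ (proj₂ (encode w))
  from : ∀ {c} → CodedTripleCondition c → StepTripleCondition (Inverse.from coding c)
  from {c₁@(_ , _ , v₁) , c₂@(_ , _ , v₂) , c₃@(_ , _ , v₃)} (s , e₁₂ , e₂₃) =
    subst (_≤ 2) (sym (cong₂ _+_ (cong₂ _+_ (flats-decode c₁) (flats-decode c₂)) (flats-decode c₃))) s ,
    trans (totalRise-decode c₁) (trans (SameEnd⇒boolRise≡ v₁ v₂ e₁₂) (sym (totalRise-decode c₂))) ,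
    trans (totalRise-decode c₂) (trans (SameEnd⇒boolRise≡ v₂ v₃ e₂₃) (sym (totalRise-decode c₃)))

FlatPattern : ℕ → ℕ → ℕ → Bool → Bool → Bool → Set
FlatPattern x₁ x₂ x₃ b₁ b₂ b₃ = flatCount b₁ + flatCount b₂ + flatCount b₃ ≤ 2 ×
  (FlatSpot x₁ b₁ × FlatSpot x₂ b₂ × FlatSpot x₃ b₃) × Balanced3 (x₁ ∸ flatCount b₁) (x₂ ∸ flatCount b₂) (x₃ ∸ flatCount b₃)

CodedTriple↔FlatPatterns : ∀ x₁ x₂ x₃ →
  CodedTriple x₁ x₂ x₃ ↔ Σ Bool λ b₁ → Σ Bool λ b₂ → Σ Bool λ b₃ → FlatPattern x₁ x₂ x₃ b₁ b₂ b₃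
CodedTriple↔FlatPatterns x₁ x₂ x₃ = mk↔ₛ′
  (λ { (((b₁ , p₁ , v₁) , (b₂ , p₂ , v₂) , (b₃ , p₃ , v₃)) , s , e) → b₁ , b₂ , b₃ , s , (p₁ , p₂ , p₃) , (v₁ , v₂ , v₃) , e })
  (λ { (b₁ , b₂ , b₃ , s , (p₁ , p₂ , p₃) , (v₁ , v₂ , v₃) , e) → ((b₁ , p₁ , v₁) , (b₂ , p₂ , v₂) , (b₃ , p₃ , v₃)) , s , e })
  (λ _ → refl) (λ _ → refl)

spotCount : ℕ → Bool → ℕ
spotCount x false = 1
spotCount x true = x

card-FlatSpot : ∀ x b → Card (FlatSpot x b) (spotCount x b)
card-FlatSpot x false = card-⊤
card-FlatSpot x true = ↔-refl

card-FlatPattern : ∀ {x₁ x₂ x₃ n} b₁ b₂ b₃ → flatCount b₁ + flatCount b₂ + flatCount b₃ ≤ 2 →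
  Card (Balanced3 (x₁ ∸ flatCount b₁) (x₂ ∸ flatCount b₂) (x₃ ∸ flatCount b₃)) n →
  Card (FlatPattern x₁ x₂ x₃ b₁ b₂ b₃) (spotCount x₁ b₁ * (spotCount x₂ b₂ * spotCount x₃ b₃) * n)
card-FlatPattern {x₁} {x₂} {x₃} b₁ b₂ b₃ le c = prop×↔ le ℕP.≤-irrelevant ⨾
  card-× (card-× (card-FlatSpot x₁ b₁) (card-× (card-FlatSpot x₂ b₂) (card-FlatSpot x₃ b₃))) c

-- One summand for each set of at most two words carrying a flat step.
card-StepTriple : ∀ x₁ x₂ x₃ {n n₃ n₂ n₂₃ n₁ n₁₃ n₁₂} →
  Card (Balanced3 x₁ x₂ x₃) n →
  Card (Balanced3 x₁ x₂ (x₃ ∸ 1)) n₃ →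
  Card (Balanced3 x₁ (x₂ ∸ 1) x₃) n₂ →
  Card (Balanced3 x₁ (x₂ ∸ 1) (x₃ ∸ 1)) n₂₃ →
  Card (Balanced3 (x₁ ∸ 1) x₂ x₃) n₁ →
  Card (Balanced3 (x₁ ∸ 1) x₂ (x₃ ∸ 1)) n₁₃ →
  Card (Balanced3 (x₁ ∸ 1) (x₂ ∸ 1) x₃) n₁₂ →
  Card (StepTriple x₁ x₂ x₃)
    (n + x₃ * n₃ + x₂ * n₂ + x₂ * x₃ * n₂₃ + x₁ * n₁ + x₁ * x₃ * n₁₃ + x₁ * x₂ * n₁₂)
card-StepTriple x₁ x₂ x₃ c c₃ c₂ c₂₃ c₁ c₁₃ c₁₂ = subst (Card _) (arrange x₁ x₂ x₃ _ _ _ _ _ _ _)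
  (StepTriple↔CodedTriple x₁ x₂ x₃ ⨾ CodedTriple↔FlatPatterns x₁ x₂ x₃ ⨾ Σ-Bool↔⊎ _ ⨾
    card-⊎ (Σ-Bool↔⊎ _ ⨾
              card-⊎ (Σ-Bool↔⊎ _ ⨾ card-⊎ (card-FlatPattern false false false z≤n c)
                                          (card-FlatPattern false false true (s≤s z≤n) c₃))
                     (Σ-Bool↔⊎ _ ⨾ card-⊎ (card-FlatPattern false true false (s≤s z≤n) c₂)
                                          (card-FlatPattern false true true (s≤s (s≤s z≤n)) c₂₃)))
           (Σ-Bool↔⊎ _ ⨾
              card-⊎ (Σ-Bool↔⊎ _ ⨾ card-⊎ (card-FlatPattern true false false (s≤s z≤n) c₁)
                                          (card-FlatPattern true false true (s≤s (s≤s z≤n)) c₁₃))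
                     (Σ-Bool↔⊎ _ ⨾ card-⊎ (card-FlatPattern true true false (s≤s (s≤s z≤n)) c₁₂)
                                          (card-empty λ { (s≤s (s≤s ()) , _) }))))
  where
  arrange : ∀ x₁ x₂ x₃ a b c d e f g →
    1 * (1 * 1) * a + 1 * (1 * x₃) * b + (1 * (x₂ * 1) * c + 1 * (x₂ * x₃) * d) +
    (x₁ * (1 * 1) * e + x₁ * (1 * x₃) * f + (x₁ * (x₂ * 1) * g + 0)) ≡
    a + x₃ * b + x₂ * c + x₂ * x₃ * d + x₁ * e + x₁ * x₃ * f + x₁ * x₂ * g
  arrange = solve-∀

stepOf : ℤ → Step
stepOf (+ zero) = flat
stepOf (+ suc _) = up
stepOf -[1+ _ ] = down

rise-stepOf : ∀ d → ∣ d ∣ ≤ 1 → rise (stepOf d) ≡ d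
rise-stepOf (+ zero) _ = refl
rise-stepOf (+ suc zero) _ = refl
rise-stepOf (+ suc (suc n)) (s≤s ())
rise-stepOf -[1+ zero ] _ = refl
rise-stepOf -[1+ suc n ] (s≤s ())

stepOf≡flat : ∀ d → stepOf d ≡ flat → d ≡ + 0
stepOf≡flat (+ zero) _ = refl

∣rise∣≤1 : ∀ a → ∣ rise a ∣ ≤ 1
∣rise∣≤1 down = s≤s z≤n
∣rise∣≤1 flat = z≤n
∣rise∣≤1 up = s≤s z≤n

∣rise∣≡1 : ∀ a → a ≢ flat → ∣ rise a ∣ ≡ 1
∣rise∣≡1 down _ = refl
∣rise∣≡1 flat a≢flat = ⊥-elim (a≢flat refl)
∣rise∣≡1 up _ = refl

rise-injective : ∀ a b → rise a ≡ rise b → a ≡ b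
rise-injective down down _ = refl
rise-injective flat flat _ = refl
rise-injective up up _ = refl

generate : (x : ℕ) → (ℕ → Step) → Vec Step x
generate zero h = []
generate (suc x) h = h 0 ∷ generate x (λ j → h (suc j))

stepAt : ∀ {x} → Vec Step x → ℕ → Step
stepAt [] _ = up  -- junk value, read only at positions below the length
stepAt (a ∷ w) zero = a
stepAt (a ∷ w) (suc n) = stepAt w n

stepAt-generate : ∀ x h j → j < x → stepAt (generate x h) j ≡ h j
stepAt-generate (suc x) h zero _ = refl
stepAt-generate (suc x) h (suc j) (s≤s j<x) = stepAt-generate x (λ j → h (suc j)) j j<x

riseUpTo : ∀ {x} → Vec Step x → ℕ → ℤ
riseUpTo w zero = + 0
riseUpTo [] (suc n) = + 0
riseUpTo (a ∷ w) (suc n) = rise a ℤ.+ riseUpTo w n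

riseUpTo-suc : ∀ {x} (w : Vec Step x) n → n < x → riseUpTo w (suc n) ≡ riseUpTo w n ℤ.+ rise (stepAt w n)
riseUpTo-suc (a ∷ w) zero _ = trans (ℤP.+-identityʳ (rise a)) (sym (ℤP.+-identityˡ (rise a)))
riseUpTo-suc (a ∷ w) (suc n) (s≤s n<x) =
  trans (cong (λ r → rise a ℤ.+ r) (riseUpTo-suc w n n<x)) (sym (ℤP.+-assoc (rise a) _ _))

riseUpTo-length : ∀ {x} (w : Vec Step x) → riseUpTo w x ≡ totalRise w
riseUpTo-length [] = refl
riseUpTo-length (a ∷ w) = cong (λ r → rise a ℤ.+ r) (riseUpTo-length w)

riseUpTo-injective : ∀ {x} (w w′ : Vec Step x) → (∀ n → n ≤ x → riseUpTo w n ≡ riseUpTo w′ n) → w ≡ w′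
riseUpTo-injective [] [] _ = refl
riseUpTo-injective (a ∷ w) (b ∷ w′) same = cong₂ _∷_ a≡b (riseUpTo-injective w w′ λ n n≤x →
  ∙-cancelˡ (rise a) _ _ (trans (same (suc n) (s≤s n≤x)) (cong (λ r → r ℤ.+ riseUpTo w′ n) (cong rise (sym a≡b)))))
  where
  a≡b : a ≡ b
  a≡b = rise-injective a b (trans (sym (ℤP.+-identityʳ (rise a))) (trans (same 1 (s≤s z≤n)) (ℤP.+-identityʳ (rise b))))

flat-position : ∀ {x} (w : Vec Step x) → 1 ≤ flats w → Σ ℕ λ z → z < x × stepAt w z ≡ flat
flat-position (flat ∷ w) _ = 0 , s≤s z≤n , refl
flat-position (down ∷ w) le with flat-position w le
... | z , z<x , e = suc z , s≤s z<x , e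
flat-position (up ∷ w) le with flat-position w le
... | z , z<x , e = suc z , s≤s z<x , e

two-flat-positions : ∀ {x} (w : Vec Step x) → ¬ (flats w ≤ 1) →
  Σ ℕ λ j₁ → Σ ℕ λ j₂ → j₁ < j₂ × j₂ < x × stepAt w j₁ ≡ flat × stepAt w j₂ ≡ flat
two-flat-positions [] ≰1 = ⊥-elim (≰1 z≤n)
two-flat-positions (flat ∷ w) ≰1 with flat-position w (ℕP.≤-pred (ℕP.≰⇒> ≰1))
... | z , z<x , e = 0 , suc z , s≤s z≤n , s≤s z<x , refl , e
two-flat-positions (down ∷ w) ≰1 with two-flat-positions w ≰1
... | j₁ , j₂ , j₁<j₂ , j₂<x , e₁ , e₂ = suc j₁ , suc j₂ , s≤s j₁<j₂ , s≤s j₂<x , e₁ , e₂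
two-flat-positions (up ∷ w) ≰1 with two-flat-positions w ≰1
... | j₁ , j₂ , j₁<j₂ , j₂<x , e₁ , e₂ = suc j₁ , suc j₂ , s≤s j₁<j₂ , s≤s j₂<x , e₁ , e₂

no-flat-step : ∀ {x} (w : Vec Step x) → flats w ≡ 0 → ∀ j → stepAt w j ≢ flat
no-flat-step (down ∷ w) e (suc j) = no-flat-step w e j
no-flat-step (up ∷ w) e (suc j) = no-flat-step w e j

flat-free-side : ∀ {x} (w : Vec Step x) → flats w ≤ 1 → ∀ n →
  (∀ j → j < n → stepAt w j ≢ flat) ⊎ (∀ j → n ≤ j → stepAt w j ≢ flat)
flat-free-side w le zero = inj₁ λ j ()
flat-free-side [] le (suc n) = inj₁ λ j _ ()
flat-free-side (flat ∷ w) (s≤s le) (suc n) =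
  inj₂ λ { zero () ; (suc j) _ → no-flat-step w (ℕP.n≤0⇒n≡0 le) j }
flat-free-side (down ∷ w) le (suc n) with flat-free-side w le n
... | inj₁ h = inj₁ λ { zero _ () ; (suc j) (s≤s j<n) → h j j<n }
... | inj₂ h = inj₂ λ { zero () ; (suc j) (s≤s n≤j) → h j n≤j }
flat-free-side (up ∷ w) le (suc n) with flat-free-side w le n
... | inj₁ h = inj₁ λ { zero _ () ; (suc j) (s≤s j<n) → h j j<n }
... | inj₂ h = inj₂ λ { zero () ; (suc j) (s≤s n≤j) → h j n≤j }

past : ℕ → ℕ → Bool
past _ zero = false
past zero (suc _) = true
past (suc z) (suc p) = past z p

past-< : ∀ {z p} → z < p → past z p ≡ true
past-< {zero} {suc p} _ = refl
past-< {suc z} {suc p} (s≤s z<p) = past-< z<p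

past-≤ : ∀ {z p} → p ≤ z → past z p ≡ false
past-≤ z≤n = refl
past-≤ (s≤s p≤z) = past-≤ p≤z

past-step : ∀ z p → p ≢ z → past z p ≡ past z (suc p)
past-step zero zero p≢z = ⊥-elim (p≢z refl)
past-step zero (suc p) _ = refl
past-step (suc z) zero _ = refl
past-step (suc z) (suc p) p≢z = past-step z p (λ e → p≢z (cong suc e))

-- Height functions on graphs glued from paths

module _ (G : Graph) where

  TightPath : (Vertex G → ℤ) → Vertex G → Vertex G → Set
  TightPath f = Star (TightAdj G f)

  tight-reverse : ∀ {f u v} → TightPath f u v → TightPath f v u
  tight-reverse = reverse λ { (e , d , inj₁ x) → e , d , inj₂ x ; (e , d , inj₂ x) → e , d , inj₁ x }

  tight-invariant : {A : Set} (f : Vertex G → ℤ) (P : Vertex G → A) →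
    (∀ e → dist G f e ≡ 1 → P (proj₁ (ends G e)) ≡ P (proj₂ (ends G e))) →
    ∀ {u v} → TightPath f u v → P u ≡ P v
  tight-invariant f P P-tight = fold (λ u v → P u ≡ P v) (λ edge rest → trans (step edge) rest) refl
    where
    step : ∀ {u v} → TightAdj G f u v → P u ≡ P v
    step (e , d , inj₁ refl) = P-tight e d
    step (e , d , inj₂ refl) = sym (P-tight e d)

  HasN-via : (D : Set) {k : ℕ} → Card D k →
    (heights : D → Vertex G → ℤ) → (∀ d → IsValid G (heights d)) →
    (classify : ∀ f → IsValid G f → D) → (∀ f v → _∼_ G f (heights (classify f v))) →
    (∀ d d′ → _∼_ G (heights d) (heights d′) → d ≡ d′) → HasN G k
  HasN-via D card heights valid classify classify-sound heights-injective = record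
    { to = λ { (f , v) → Inverse.to card (classify f v) }
    ; cong = λ { {f , v} {f′ , v′} f∼f′ → cong (Inverse.to card) (same-class f∼f′) }
    ; bijective = injective , surjective }
    where
    _≈_ = _∼_ G
    ≈-sym : ∀ a b → a ≈ b → b ≈ a
    ≈-sym a b = ∼-sym G {a} {b}
    ≈-trans : ∀ a b c → a ≈ b → b ≈ c → a ≈ c
    ≈-trans a b c = ∼-trans G {a} {b} {c}
    ≈-classify : ∀ {f f′ v v′} → f ≈ f′ → heights (classify f v) ≈ heights (classify f′ v′)
    ≈-classify {f} {f′} {v} {v′} f≈f′ =
      ≈-trans _ f (heights (classify f′ v′)) (≈-sym f _ (classify-sound f v))
        (≈-trans f f′ (heights (classify f′ v′)) f≈f′ (classify-sound f′ v′))
    same-class : ∀ {f f′ v v′} → f ≈ f′ → classify f v ≡ classify f′ v′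
    same-class f≈f′ = heights-injective _ _ (≈-classify f≈f′)
    injective : ∀ {x y} → Inverse.to card (classify (proj₁ x) (proj₂ x)) ≡ Inverse.to card (classify (proj₁ y) (proj₂ y)) →
                proj₁ x ≈ proj₁ y
    injective {f , v} {f′ , v′} e = ≈-trans f _ f′ (classify-sound f v)
      (subst (λ d → heights d ≈ f′) (sym same) (≈-sym f′ _ (classify-sound f′ v′)))
      where
      same : classify f v ≡ classify f′ v′
      same = trans (sym (Inverse.strictlyInverseʳ card _)) (trans (cong (Inverse.from card) e) (Inverse.strictlyInverseʳ card _))
    surjective : ∀ y → ∃ λ x → ∀ {z} → proj₁ z ≈ proj₁ x → Inverse.to card (classify (proj₁ z) (proj₂ z)) ≡ y
    surjective y = (heights d , valid d) , λ { {f , v} f≈ →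
      trans (cong (Inverse.to card) (heights-injective _ _ (≈-trans _ f (heights d) (≈-sym f _ (classify-sound f v)) f≈)))
            (Inverse.strictlyInverseˡ card y) }
      where d = Inverse.from card y

pathVertex-by : ∀ {A B : Set} (s t : B) (x : ℕ) (Φ : B ⊎ Fin (x ∸ 1) → A) (q : ℕ → A) →
  q 0 ≡ Φ (inj₁ s) → q x ≡ Φ (inj₁ t) → (∀ k → q (suc (toℕ k)) ≡ Φ (inj₂ k)) →
  ∀ n → n ≤ x → Φ (pathVertex s t x n) ≡ q n
pathVertex-by s t x Φ q q-start q-end q-inner zero _ = sym q-start
pathVertex-by s t x Φ q q-start q-end q-inner (suc k) 1+k≤x with k <? x ∸ 1
... | yes k<x-1 = trans (sym (q-inner (fromℕ< k<x-1))) (cong (λ z → q (suc z)) (FinP.toℕ-fromℕ< k<x-1))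
... | no k≮x-1 = trans (sym q-end) (cong q (sym (last k x 1+k≤x k≮x-1)))
  where
  last : ∀ k x → suc k ≤ x → ¬ (k < x ∸ 1) → suc k ≡ x
  last k (suc x) (s≤s k≤x) k≮x = cong suc (ℕP.≤-antisym k≤x (ℕP.≮⇒≥ k≮x))

pathVertex-end : ∀ {B : Set} (s t : B) x → 1 ≤ x → pathVertex s t x x ≡ inj₁ t
pathVertex-end s t (suc x) _ with x <? suc x ∸ 1
... | yes x<x = ⊥-elim (ℕP.<-irrefl refl x<x)
... | no _ = refl

pathVertex-inner : ∀ {B : Set} (s t : B) x (k : Fin (x ∸ 1)) → pathVertex s t x (suc (toℕ k)) ≡ inj₂ k
pathVertex-inner s t x k with toℕ k <? x ∸ 1
... | yes k<x-1 = cong inj₂ (FinP.fromℕ<-toℕ k k<x-1)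
... | no k≮x-1 = ⊥-elim (k≮x-1 (FinP.toℕ<n k))

module PathGlued (B : Set) (m : ℕ) (len : Fin m → ℕ) (s t : Fin m → B) (nonempty : ∀ i → 1 ≤ len i) where

  G : Graph
  G = PathGlue B m len s t

  V : Set
  V = Vertex G

  onPath : (i : Fin m) → B ⊎ Fin (len i ∸ 1) → V
  onPath i (inj₁ b) = inj₁ b
  onPath i (inj₂ k) = inj₂ (i , k)

  vertexAt : Fin m → ℕ → V
  vertexAt i n = onPath i (pathVertex (s i) (t i) (len i) n)

  ends-edge : ∀ i j → ends G (i , j) ≡ (vertexAt i (toℕ j) , vertexAt i (suc (toℕ j)))
  ends-edge i j with pathVertex (s i) (t i) (len i) (toℕ j) | pathVertex (s i) (t i) (len i) (suc (toℕ j))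
  ... | inj₁ _ | inj₁ _ = refl
  ... | inj₁ _ | inj₂ _ = refl
  ... | inj₂ _ | inj₁ _ = refl
  ... | inj₂ _ | inj₂ _ = refl

  vertexAt-end : ∀ i → vertexAt i (len i) ≡ inj₁ (t i)
  vertexAt-end i = cong (onPath i) (pathVertex-end (s i) (t i) (len i) (nonempty i))

  inner<len : ∀ i (k : Fin (len i ∸ 1)) → suc (toℕ k) ≤ len i
  inner<len i k = ℕP.≤-trans (FinP.toℕ<n k) (ℕP.m∸n≤m (len i) 1)

  vertexAt-inner : ∀ i (k : Fin (len i ∸ 1)) → vertexAt i (suc (toℕ k)) ≡ inj₂ (i , k)
  vertexAt-inner i k = cong (onPath i) (pathVertex-inner (s i) (t i) (len i) k)

  byPosition : {A : Set} → (B → A) → (Fin m → ℕ → A) → V → A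
  byPosition on-base on-path (inj₁ b) = on-base b
  byPosition on-base on-path (inj₂ (i , k)) = on-path i (suc (toℕ k))

  byPosition-vertexAt : {A : Set} (on-base : B → A) (on-path : Fin m → ℕ → A) →
    (∀ i → on-path i 0 ≡ on-base (s i)) → (∀ i → on-path i (len i) ≡ on-base (t i)) →
    ∀ i n → n ≤ len i → byPosition on-base on-path (vertexAt i n) ≡ on-path i n
  byPosition-vertexAt on-base on-path start end i =
    pathVertex-by (s i) (t i) (len i) (λ v → byPosition on-base on-path (onPath i v)) (on-path i)
      (start i) (end i) (λ _ → refl)

  dist-edge : ∀ (f : V → ℤ) i j → dist G f (i , j) ≡ ∣ f (vertexAt i (toℕ j)) ℤ.- f (vertexAt i (suc (toℕ j))) ∣
  dist-edge f i j = cong (λ e → ∣ f (proj₁ e) ℤ.- f (proj₂ e) ∣) (ends-edge i j)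

  edgeAt : ∀ i j → j < len i → Edge G
  edgeAt i j j<len = i , fromℕ< j<len

  ends-edgeAt : ∀ i j (j<len : j < len i) → ends G (edgeAt i j j<len) ≡ (vertexAt i j , vertexAt i (suc j))
  ends-edgeAt i j j<len = trans (ends-edge i (fromℕ< j<len))
    (cong (λ z → vertexAt i z , vertexAt i (suc z)) (FinP.toℕ-fromℕ< j<len))

  path-invariant : (f : V → ℤ) (on-base : B → Bool) (on-path : Fin m → ℕ → Bool) →
    (∀ i → on-path i 0 ≡ on-base (s i)) → (∀ i → on-path i (len i) ≡ on-base (t i)) →
    (∀ i (j : Fin (len i)) → dist G f (i , j) ≡ 1 → on-path i (toℕ j) ≡ on-path i (suc (toℕ j))) →
    ∀ {u v} → TightPath G f u v → byPosition on-base on-path u ≡ byPosition on-base on-path v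
  path-invariant f on-base on-path start end tight = tight-invariant G f P λ { (i , j) d → begin
      P (proj₁ (ends G (i , j)))      ≡⟨ cong (λ e → P (proj₁ e)) (ends-edge i j) ⟩
      P (vertexAt i (toℕ j))          ≡⟨ P-at i (toℕ j) (ℕP.<⇒≤ (FinP.toℕ<n j)) ⟩
      on-path i (toℕ j)               ≡⟨ tight i j d ⟩
      on-path i (suc (toℕ j))         ≡⟨ P-at i (suc (toℕ j)) (FinP.toℕ<n j) ⟨
      P (vertexAt i (suc (toℕ j)))    ≡⟨ cong (λ e → P (proj₂ e)) (ends-edge i j) ⟨
      P (proj₂ (ends G (i , j)))      ∎ }
    where
    open ≡-Reasoning
    P = byPosition on-base on-path
    P-at = byPosition-vertexAt on-base on-path start end

  walk-to-start : (f : V → ℤ) (i : Fin m) (n : ℕ) → n ≤ len i →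
    (∀ j (j<len : j < len i) → j < n → dist G f (edgeAt i j j<len) ≡ 1) →
    TightPath G f (vertexAt i n) (vertexAt i 0)
  walk-to-start f i zero _ _ = ε
  walk-to-start f i (suc n) n<len tight =
    (edgeAt i n n<len , tight n n<len (ℕP.n<1+n n) , inj₂ (ends-edgeAt i n n<len)) ◅
    walk-to-start f i n (ℕP.<⇒≤ n<len) (λ j j<len j<n → tight j j<len (ℕP.m<n⇒m<1+n j<n))

  walk-to-end : (f : V → ℤ) (i : Fin m) (d n : ℕ) → n + d ≡ len i →
    (∀ j (j<len : j < len i) → n ≤ j → dist G f (edgeAt i j j<len) ≡ 1) →
    TightPath G f (vertexAt i n) (vertexAt i (len i))
  walk-to-end f i zero n n+0≡len _ =
    subst (λ z → TightPath G f (vertexAt i n) (vertexAt i z)) (trans (sym (ℕP.+-identityʳ n)) n+0≡len) ε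
  walk-to-end f i (suc d) n n+d≡len tight =
    (edgeAt i n n<len , tight n n<len ℕP.≤-refl , inj₁ (ends-edgeAt i n n<len)) ◅
    walk-to-end f i d (suc n) (trans (sym (ℕP.+-suc n d)) n+d≡len) (λ j j<len n<j → tight j j<len (ℕP.<⇒≤ n<j))
    where
    n<len : n < len i
    n<len = subst (n <_) n+d≡len (ℕP.m<m+n n (s≤s z≤n))

  Steps : Set
  Steps = (i : Fin m) → Vec Step (len i)

  stepsOf : (V → ℤ) → Steps
  stepsOf f i = generate (len i) (λ j → stepOf (f (vertexAt i (suc j)) ℤ.- f (vertexAt i j)))

  height-along : ∀ (f : V → ℤ) → (∀ e → dist G f e ≤ 1) → ∀ i n → n ≤ len i →
    f (vertexAt i n) ≡ f (vertexAt i 0) ℤ.+ riseUpTo (stepsOf f i) n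
  height-along f short i zero _ = sym (ℤP.+-identityʳ _)
  height-along f short i (suc n) n<len = begin
      f (vertexAt i (suc n))                      ≡⟨ split (f (vertexAt i (suc n))) (f (vertexAt i n)) ⟩
      f (vertexAt i n) ℤ.+ d                      ≡⟨ cong (ℤ._+ d) (height-along f short i n (ℕP.<⇒≤ n<len)) ⟩
      f (vertexAt i 0) ℤ.+ riseUpTo w n ℤ.+ d     ≡⟨ ℤP.+-assoc (f (vertexAt i 0)) (riseUpTo w n) d ⟩
      f (vertexAt i 0) ℤ.+ (riseUpTo w n ℤ.+ d)   ≡⟨ cong (λ z → f (vertexAt i 0) ℤ.+ (riseUpTo w n ℤ.+ z)) rise≡d ⟨
      f (vertexAt i 0) ℤ.+ (riseUpTo w n ℤ.+ rise (stepAt w n))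
                                                  ≡⟨ cong (λ z → f (vertexAt i 0) ℤ.+ z) (riseUpTo-suc w n n<len) ⟨
      f (vertexAt i 0) ℤ.+ riseUpTo w (suc n)     ∎
    where
    open ≡-Reasoning
    w = stepsOf f i
    d = f (vertexAt i (suc n)) ℤ.- f (vertexAt i n)
    split : ∀ a b → a ≡ b ℤ.+ (a ℤ.- b)
    split = ℤ-Ring.solve-∀
    ∣d∣≤1 : ∣ d ∣ ≤ 1
    ∣d∣≤1 = subst (_≤ 1)
      (trans (cong (λ e → ∣ f (proj₁ e) ℤ.- f (proj₂ e) ∣) (ends-edgeAt i n n<len))
             (ℤP.∣i-j∣≡∣j-i∣ (f (vertexAt i n)) (f (vertexAt i (suc n)))))
      (short (edgeAt i n n<len))
    rise≡d : rise (stepAt w n) ≡ d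
    rise≡d = trans (cong rise (stepAt-generate (len i) _ n n<len)) (rise-stepOf d ∣d∣≤1)

  end-height : ∀ (f : V → ℤ) → (∀ e → dist G f e ≤ 1) → ∀ i →
    f (inj₁ (t i)) ≡ f (inj₁ (s i)) ℤ.+ totalRise (stepsOf f i)
  end-height f short i = trans (cong f (sym (vertexAt-end i)))
    (trans (height-along f short i (len i) ℕP.≤-refl) (cong (λ r → f (inj₁ (s i)) ℤ.+ r) (riseUpTo-length (stepsOf f i))))

  tight⇒non-flat : (f : V → ℤ) → ∀ i (j : Fin (len i)) → dist G f (i , j) ≡ 1 → stepAt (stepsOf f i) (toℕ j) ≢ flat
  tight⇒non-flat f i j tight is-flat = 0≢1 (trans (sym dist≡0) tight)
    where
    a = f (vertexAt i (toℕ j))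
    b = f (vertexAt i (suc (toℕ j)))
    b-a≡0 : b ℤ.- a ≡ + 0
    b-a≡0 = stepOf≡flat (b ℤ.- a) (trans (sym (stepAt-generate (len i) _ (toℕ j) (FinP.toℕ<n j))) is-flat)
    dist≡0 : dist G f (i , j) ≡ 0
    dist≡0 = trans (dist-edge f i j) (trans (ℤP.∣i-j∣≡∣j-i∣ a b) (cong ∣_∣ b-a≡0))
    0≢1 : 0 ≢ 1
    0≢1 ()

  -- Two flat edges on one path would cut off the vertices strictly between them.
  valid⇒flats≤1 : ∀ f → IsValid G f → ∀ i₀ → flats (stepsOf f i₀) ≤ 1
  valid⇒flats≤1 f (_ , connected) i₀ with flats (stepsOf f i₀) ≤? 1
  ... | yes ≤1 = ≤1
  ... | no ≰1 with two-flat-positions (stepsOf f i₀) ≰1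
  ... | j₁ , j₂ , j₁<j₂ , j₂<len , flat₁ , flat₂ = ⊥-elim (true≢false cut-off)
    where
    true≢false : true ≢ false
    true≢false ()
    between : ℕ → Bool
    between p = past j₁ p ∧ not (past j₂ p)
    inside : Fin m → ℕ → Bool
    inside i p with i Fin.≟ i₀
    ... | yes _ = between p
    ... | no _ = false
    inside-i₀ : ∀ p → inside i₀ p ≡ between p
    inside-i₀ p with i₀ Fin.≟ i₀
    ... | yes _ = refl
    ... | no i₀≢i₀ = ⊥-elim (i₀≢i₀ refl)
    start : ∀ i → inside i 0 ≡ false
    start i with i Fin.≟ i₀
    ... | yes _ = refl
    ... | no _ = refl
    end : ∀ i → inside i (len i) ≡ false
    end i with i Fin.≟ i₀
    ... | yes refl rewrite past-< j₂<len = ∧-zeroʳ (past j₁ (len i₀))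
    ... | no _ = refl
    tight : ∀ i (j : Fin (len i)) → dist G f (i , j) ≡ 1 → inside i (toℕ j) ≡ inside i (suc (toℕ j))
    tight i j d with i Fin.≟ i₀
    ... | yes refl = cong₂ (λ a b → a ∧ not b) (past-step j₁ (toℕ j) (not-at flat₁)) (past-step j₂ (toℕ j) (not-at flat₂))
      where
      not-at : ∀ {z} → stepAt (stepsOf f i) z ≡ flat → toℕ j ≢ z
      not-at is-flat refl = tight⇒non-flat f i j d is-flat
    ... | no _ = refl
    inside-start : byPosition (λ _ → false) inside (vertexAt i₀ (suc j₁)) ≡ true
    inside-start = trans (byPosition-vertexAt (λ _ → false) inside start end i₀ (suc j₁) (ℕP.≤-trans j₁<j₂ (ℕP.<⇒≤ j₂<len)))
      (trans (inside-i₀ (suc j₁))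
        (cong₂ (λ a b → a ∧ not b) (past-< (ℕP.n<1+n j₁)) (past-≤ j₁<j₂)))
    cut-off : true ≡ false
    cut-off = trans (sym inside-start)
      (path-invariant f (λ _ → false) inside start end tight (connected (vertexAt i₀ (suc j₁)) (inj₁ (s i₀))))

  Consistent : (B → ℤ) → Steps → Set
  Consistent base w = ∀ i → base (t i) ≡ base (s i) ℤ.+ totalRise (w i)

  heights : (B → ℤ) → Steps → V → ℤ
  heights base w = byPosition base (λ i n → base (s i) ℤ.+ riseUpTo (w i) n)

  heights-cong : ∀ base {w w′ : Steps} → (∀ i → w i ≡ w′ i) → ∀ v → heights base w v ≡ heights base w′ v
  heights-cong base w≗w′ (inj₁ b) = refl
  heights-cong base w≗w′ (inj₂ (i , k)) = cong (λ z → base (s i) ℤ.+ riseUpTo z (suc (toℕ k))) (w≗w′ i)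

  module _ {base : B → ℤ} {w : Steps} (consistent : Consistent base w) where

    heights-vertexAt : ∀ i n → n ≤ len i → heights base w (vertexAt i n) ≡ base (s i) ℤ.+ riseUpTo (w i) n
    heights-vertexAt = byPosition-vertexAt base (λ i n → base (s i) ℤ.+ riseUpTo (w i) n)
      (λ i → ℤP.+-identityʳ (base (s i)))
      (λ i → trans (cong (λ z → base (s i) ℤ.+ z) (riseUpTo-length (w i))) (sym (consistent i)))

    dist-heights : ∀ i (j : Fin (len i)) → dist G (heights base w) (i , j) ≡ ∣ rise (stepAt (w i) (toℕ j)) ∣
    dist-heights i j = begin
        dist G (heights base w) (i , j)
          ≡⟨ dist-edge (heights base w) i j ⟩
        ∣ heights base w (vertexAt i (toℕ j)) ℤ.- heights base w (vertexAt i (suc (toℕ j))) ∣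
          ≡⟨ cong₂ (λ a b → ∣ a ℤ.- b ∣) (heights-vertexAt i (toℕ j) (ℕP.<⇒≤ (FinP.toℕ<n j)))
                                          (heights-vertexAt i (suc (toℕ j)) (FinP.toℕ<n j)) ⟩
        ∣ (h ℤ.+ r) ℤ.- (h ℤ.+ riseUpTo (w i) (suc (toℕ j))) ∣
          ≡⟨ cong (λ z → ∣ (h ℤ.+ r) ℤ.- (h ℤ.+ z) ∣) (riseUpTo-suc (w i) (toℕ j) (FinP.toℕ<n j)) ⟩
        ∣ (h ℤ.+ r) ℤ.- (h ℤ.+ (r ℤ.+ x)) ∣
          ≡⟨ cong ∣_∣ (cancel h r x) ⟩
        ∣ ℤ.- x ∣
          ≡⟨ ℤP.∣-i∣≡∣i∣ x ⟩
        ∣ x ∣ ∎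
      where
      open ≡-Reasoning
      h = base (s i)
      r = riseUpTo (w i) (toℕ j)
      x = rise (stepAt (w i) (toℕ j))
      cancel : ∀ h r x → (h ℤ.+ r) ℤ.- (h ℤ.+ (r ℤ.+ x)) ≡ ℤ.- x
      cancel = ℤ-Ring.solve-∀

    heights-short : ∀ e → dist G (heights base w) e ≤ 1
    heights-short (i , j) = subst (_≤ 1) (sym (dist-heights i j)) (∣rise∣≤1 (stepAt (w i) (toℕ j)))

    heights-tight : ∀ i j (j<len : j < len i) → stepAt (w i) j ≢ flat → dist G (heights base w) (edgeAt i j j<len) ≡ 1
    heights-tight i j j<len non-flat = trans (dist-heights i (fromℕ< j<len))
      (∣rise∣≡1 _ (subst (λ z → stepAt (w i) z ≢ flat) (sym (FinP.toℕ-fromℕ< j<len)) non-flat))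

    flat-free-path : ∀ i → flats (w i) ≡ 0 → TightPath G (heights base w) (inj₁ (t i)) (inj₁ (s i))
    flat-free-path i no-flat = subst (λ v → TightPath G (heights base w) v (inj₁ (s i))) (vertexAt-end i)
      (walk-to-start (heights base w) i (len i) ℕP.≤-refl λ j j<len _ → heights-tight i j j<len (no-flat-step (w i) no-flat j))

    inner-reaches-end : ∀ i → flats (w i) ≤ 1 → ∀ (k : Fin (len i ∸ 1)) →
      TightPath G (heights base w) (inj₂ (i , k)) (inj₁ (s i)) ⊎ TightPath G (heights base w) (inj₂ (i , k)) (inj₁ (t i))
    inner-reaches-end i ≤1 k with flat-free-side (w i) ≤1 (suc (toℕ k))
    ... | inj₁ below = inj₁ (subst (λ v → TightPath G (heights base w) v (inj₁ (s i))) (vertexAt-inner i k)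
            (walk-to-start (heights base w) i (suc (toℕ k)) (inner<len i k) λ j j<len j≤k → heights-tight i j j<len (below j j≤k)))
    ... | inj₂ above = inj₂ (subst₂ (TightPath G (heights base w)) (vertexAt-inner i k) (vertexAt-end i)
            (walk-to-end (heights base w) i (len i ∸ suc (toℕ k)) (suc (toℕ k)) (ℕP.m+[n∸m]≡n (inner<len i k))
              λ j j<len k<j → heights-tight i j j<len (above j k<j)))

  heights-injective : ∀ {base base′ w w′} → Consistent base w → Consistent base′ w′ →
    (∀ v → heights base w v ≡ heights base′ w′ v) → ∀ i → w i ≡ w′ i
  heights-injective {base} {base′} {w} {w′} c c′ same i = riseUpTo-injective (w i) (w′ i) λ n n≤len →
    ∙-cancelˡ (base (s i)) _ _ (begin
      base (s i) ℤ.+ riseUpTo (w i) n     ≡⟨ heights-vertexAt c i n n≤len ⟨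
      heights base w (vertexAt i n)       ≡⟨ same (vertexAt i n) ⟩
      heights base′ w′ (vertexAt i n)     ≡⟨ heights-vertexAt c′ i n n≤len ⟩
      base′ (s i) ℤ.+ riseUpTo (w′ i) n   ≡⟨ cong (λ h → h ℤ.+ riseUpTo (w′ i) n) (same (inj₁ (s i))) ⟨
      base (s i) ℤ.+ riseUpTo (w′ i) n    ∎)
    where open ≡-Reasoning

  ≈heights : ∀ (f : V → ℤ) → (∀ e → dist G f e ≤ 1) → ∀ base c → (∀ b → f (inj₁ b) ≡ base b ℤ.+ c) →
    ∀ v → f v ≡ heights base (stepsOf f) v ℤ.+ c
  ≈heights f short base c on-base (inj₁ b) = on-base b
  ≈heights f short base c on-base (inj₂ (i , k)) = begin
      f (inj₂ (i , k))                                ≡⟨ cong f (vertexAt-inner i k) ⟨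
      f (vertexAt i (suc (toℕ k)))                    ≡⟨ height-along f short i (suc (toℕ k)) (inner<len i k) ⟩
      f (inj₁ (s i)) ℤ.+ r                            ≡⟨ cong (ℤ._+ r) (on-base (s i)) ⟩
      base (s i) ℤ.+ c ℤ.+ r                          ≡⟨ swap (base (s i)) c r ⟩
      base (s i) ℤ.+ r ℤ.+ c                          ∎
    where
    open ≡-Reasoning
    r = riseUpTo (stepsOf f i) (suc (toℕ k))
    swap : ∀ a b c → a ℤ.+ b ℤ.+ c ≡ a ℤ.+ c ℤ.+ b
    swap = ℤ-Ring.solve-∀

  record StepCoding (b₀ : B) (k : ℕ) : Set₁ where
    field
      Code : Set
      card : Card Code k
      base : Code → B → ℤ
      steps : Code → Steps
      consistent : ∀ d → Consistent (base d) (steps d)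
      base-b₀ : ∀ d → base d b₀ ≡ + 0
      few-flats : ∀ d i → flats (steps d i) ≤ 1
      base-reaches-b₀ : ∀ d b → TightPath G (heights (base d) (steps d)) (inj₁ b) (inj₁ b₀)
      steps-injective : ∀ d d′ → (∀ i → steps d i ≡ steps d′ i) → d ≡ d′
      classify : ∀ f → IsValid G f → Code
      classify-steps : ∀ f v i → steps (classify f v) i ≡ stepsOf f i
      classify-base : ∀ f v b → f (inj₁ b) ≡ base (classify f v) b ℤ.+ f (inj₁ b₀)

  StepCoding⇒HasN : ∀ {b₀ k} → StepCoding b₀ k → HasN G k
  StepCoding⇒HasN {b₀} coding = HasN-via G Code card heightsOf valid classify sound injective
    where
    open StepCoding coding
    heightsOf : Code → V → ℤ
    heightsOf d = heights (base d) (steps d)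
    reaches-b₀ : ∀ d u → TightPath G (heightsOf d) u (inj₁ b₀)
    reaches-b₀ d (inj₁ b) = base-reaches-b₀ d b
    reaches-b₀ d (inj₂ (i , k)) with inner-reaches-end (consistent d) i (few-flats d i) k
    ... | inj₁ to-s = to-s ◅◅ base-reaches-b₀ d (s i)
    ... | inj₂ to-t = to-t ◅◅ base-reaches-b₀ d (t i)
    valid : ∀ d → IsValid G (heightsOf d)
    valid d = heights-short (consistent d) , λ u v → reaches-b₀ d u ◅◅ tight-reverse G {heightsOf d} (reaches-b₀ d v)
    sound : ∀ f v → _∼_ G f (heightsOf (classify f v))
    sound f v = f (inj₁ b₀) , λ u →
      trans (≈heights f (proj₁ v) (base (classify f v)) (f (inj₁ b₀)) (classify-base f v) u)
            (cong (ℤ._+ f (inj₁ b₀)) (heights-cong _ (λ i → sym (classify-steps f v i)) u))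
    injective : ∀ d d′ → _∼_ G (heightsOf d) (heightsOf d′) → d ≡ d′
    injective d d′ (c , same) = steps-injective d d′ (heights-injective (consistent d) (consistent d′) same′)
      where
      c≡0 : c ≡ + 0
      c≡0 = sym (trans (trans (sym (base-b₀ d)) (same (inj₁ b₀)))
                       (trans (cong (ℤ._+ c) (base-b₀ d′)) (ℤP.+-identityˡ c)))
      same′ : ∀ u → heightsOf d u ≡ heightsOf d′ u
      same′ u = trans (same u) (trans (cong (λ z → heightsOf d′ u ℤ.+ z) c≡0) (ℤP.+-identityʳ _))

module Theta (m : ℕ) (len : Fin m → ℕ) (nonempty : ∀ i → 1 ≤ len i) where

  open PathGlued Bool m len (λ _ → false) (λ _ → true) nonempty

  -- If every path had a flat edge, nothing past the first flat edge of any path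
  -- could be reached from the first base vertex.
  valid⇒¬all-paths-flat : ∀ f → IsValid G f → ¬ (∀ i → 1 ≤ flats (stepsOf f i))
  valid⇒¬all-paths-flat f (_ , connected) all-flat = true≢false disconnected
    where
    true≢false : true ≢ false
    true≢false ()
    first-flat : ∀ i → ℕ
    first-flat i = proj₁ (flat-position (stepsOf f i) (all-flat i))
    before : Fin m → ℕ → Bool
    before i p = not (past (first-flat i) p)
    end : ∀ i → before i (len i) ≡ false
    end i = cong not (past-< (proj₁ (proj₂ (flat-position (stepsOf f i) (all-flat i)))))
    tight : ∀ i (j : Fin (len i)) → dist G f (i , j) ≡ 1 → before i (toℕ j) ≡ before i (suc (toℕ j))
    tight i j d = cong not (past-step (first-flat i) (toℕ j) λ at-flat →
      tight⇒non-flat f i j d (subst (λ z → stepAt (stepsOf f i) z ≡ flat) (sym at-flat)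
        (proj₂ (proj₂ (flat-position (stepsOf f i) (all-flat i))))))
    disconnected : true ≡ false
    disconnected = path-invariant f not before (λ _ → refl) end tight (connected (inj₁ false) (inj₁ true))

-- The theta graph, the bouquet of two cycles and the cycle

sum≤2⇒some-zero : ∀ {a b c} → a ≤ 1 → b ≤ 1 → c ≤ 1 → a + b + c ≤ 2 → a ≡ 0 ⊎ b ≡ 0 ⊎ c ≡ 0
sum≤2⇒some-zero z≤n _ _ _ = inj₁ refl
sum≤2⇒some-zero (s≤s z≤n) z≤n _ _ = inj₂ (inj₁ refl)
sum≤2⇒some-zero (s≤s z≤n) (s≤s z≤n) z≤n _ = inj₂ (inj₂ refl)
sum≤2⇒some-zero (s≤s z≤n) (s≤s z≤n) (s≤s z≤n) (s≤s (s≤s ()))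

no-zero⇒sum≤2 : ∀ {a b c} → a ≤ 1 → b ≤ 1 → c ≤ 1 → ¬ (1 ≤ a × 1 ≤ b × 1 ≤ c) → a + b + c ≤ 2
no-zero⇒sum≤2 (s≤s z≤n) (s≤s z≤n) (s≤s z≤n) ¬all = ⊥-elim (¬all (s≤s z≤n , s≤s z≤n , s≤s z≤n))
no-zero⇒sum≤2 z≤n z≤n z≤n _ = z≤n
no-zero⇒sum≤2 z≤n z≤n (s≤s z≤n) _ = s≤s z≤n
no-zero⇒sum≤2 z≤n (s≤s z≤n) z≤n _ = s≤s z≤n
no-zero⇒sum≤2 z≤n (s≤s z≤n) (s≤s z≤n) _ = s≤s (s≤s z≤n)
no-zero⇒sum≤2 (s≤s z≤n) z≤n z≤n _ = s≤s z≤n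
no-zero⇒sum≤2 (s≤s z≤n) z≤n (s≤s z≤n) _ = s≤s (s≤s z≤n)
no-zero⇒sum≤2 (s≤s z≤n) (s≤s z≤n) z≤n _ = s≤s (s≤s z≤n)

StepTriple-≡ : ∀ {x₁ x₂ x₃} (d d′ : StepTriple x₁ x₂ x₃) →
  proj₁ (proj₁ (proj₁ d)) ≡ proj₁ (proj₁ (proj₁ d′)) →
  proj₁ (proj₁ (proj₂ (proj₁ d))) ≡ proj₁ (proj₁ (proj₂ (proj₁ d′))) →
  proj₁ (proj₂ (proj₂ (proj₁ d))) ≡ proj₁ (proj₂ (proj₂ (proj₁ d′))) → d ≡ d′
StepTriple-≡ (((w₁ , l₁) , (w₂ , l₂) , (w₃ , l₃)) , le , e₁₂ , e₂₃)
             (((.w₁ , l₁′) , (.w₂ , l₂′) , (.w₃ , l₃′)) , le′ , e₁₂′ , e₂₃′) refl refl refl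
  rewrite ℕP.≤-irrelevant l₁ l₁′ | ℕP.≤-irrelevant l₂ l₂′ | ℕP.≤-irrelevant l₃ l₃′
        | ℕP.≤-irrelevant le le′ | uip e₁₂ e₁₂′ | uip e₂₃ e₂₃′ = refl

module _ {len : Fin 3 → ℕ} (nonempty : ∀ i → 1 ≤ len i) where

  open PathGlued Bool 3 len (λ _ → false) (λ _ → true) nonempty
  open Theta 3 len nonempty

  HasN-theta : ∀ {k} → Card (StepTriple (len 0F) (len 1F) (len 2F)) k → HasN G k
  HasN-theta card = StepCoding⇒HasN record
    { Code = StepTriple (len 0F) (len 1F) (len 2F)
    ; card = card
    ; base = base
    ; steps = steps
    ; consistent = consistent
    ; base-b₀ = λ _ → refl
    ; few-flats = few-flats
    ; base-reaches-b₀ = base-reaches-false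
    ; steps-injective = λ d d′ same → StepTriple-≡ d d′ (same 0F) (same 1F) (same 2F)
    ; classify = classify
    ; classify-steps = λ { f v 0F → refl ; f v 1F → refl ; f v 2F → refl }
    ; classify-base = classify-base
    }
    where
    Code = StepTriple (len 0F) (len 1F) (len 2F)
    steps : Code → Steps
    steps (((w₁ , _) , _) , _) 0F = w₁
    steps ((_ , (w₂ , _) , _) , _) 1F = w₂
    steps ((_ , _ , (w₃ , _)) , _) 2F = w₃
    base : Code → Bool → ℤ
    base d false = + 0
    base d true = totalRise (steps d 0F)
    consistent : ∀ d → Consistent (base d) (steps d)
    consistent _ 0F = sym (ℤP.+-identityˡ _)
    consistent (_ , _ , e₁₂ , _) 1F = trans e₁₂ (sym (ℤP.+-identityˡ _))
    consistent (_ , _ , e₁₂ , e₂₃) 2F = trans (trans e₁₂ e₂₃) (sym (ℤP.+-identityˡ _))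
    few-flats : ∀ d i → flats (steps d i) ≤ 1
    few-flats (((_ , l₁) , _) , _) 0F = l₁
    few-flats ((_ , (_ , l₂) , _) , _) 1F = l₂
    few-flats ((_ , _ , (_ , l₃)) , _) 2F = l₃
    -- At most two of the three words have a flat step, so some path is tight throughout.
    base-reaches-false : ∀ d b → TightPath G (heights (base d) (steps d)) (inj₁ b) (inj₁ false)
    base-reaches-false d false = ε
    base-reaches-false d@(((_ , l₁) , (_ , l₂) , (_ , l₃)) , le , _) true with sum≤2⇒some-zero l₁ l₂ l₃ le
    ... | inj₁ none = flat-free-path (consistent d) 0F none
    ... | inj₂ (inj₁ none) = flat-free-path (consistent d) 1F none
    ... | inj₂ (inj₂ none) = flat-free-path (consistent d) 2F none
    classify : ∀ f → IsValid G f → Code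
    classify f v = ((stepsOf f 0F , ≤1 0F) , (stepsOf f 1F , ≤1 1F) , (stepsOf f 2F , ≤1 2F)) ,
      no-zero⇒sum≤2 (≤1 0F) (≤1 1F) (≤1 2F)
        (λ { (f₁ , f₂ , f₃) → valid⇒¬all-paths-flat f v λ { 0F → f₁ ; 1F → f₂ ; 2F → f₃ } }) ,
      ∙-cancelˡ (f (inj₁ false)) _ _ (trans (sym (end 0F)) (end 1F)) ,
      ∙-cancelˡ (f (inj₁ false)) _ _ (trans (sym (end 1F)) (end 2F))
      where
      ≤1 = valid⇒flats≤1 f v
      end = end-height f (proj₁ v)
    classify-base : ∀ f v b → f (inj₁ b) ≡ base (classify f v) b ℤ.+ f (inj₁ false)
    classify-base f v false = sym (ℤP.+-identityˡ _)
    classify-base f v true = trans (end-height f (proj₁ v) 0F) (ℤP.+-comm (f (inj₁ false)) _)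

module Loops (m : ℕ) (len : Fin m → ℕ) (nonempty : ∀ i → 1 ≤ len i) where

  open PathGlued ⊤ m len (λ _ → tt) (λ _ → tt) nonempty public

  loop-rise≡0 : ∀ f → IsValid G f → ∀ i → totalRise (stepsOf f i) ≡ + 0
  loop-rise≡0 f v i = ∙-cancelˡ (f (inj₁ tt)) _ _ (trans (sym (end-height f (proj₁ v) i)) (sym (ℤP.+-identityʳ _)))

  zero-consistent : ∀ {w : Steps} → (∀ i → totalRise (w i) ≡ + 0) → Consistent (λ _ → + 0) w
  zero-consistent rise≡0 i = sym (trans (ℤP.+-identityˡ _) (rise≡0 i))

  classify-base : ∀ (f : V → ℤ) b → f (inj₁ b) ≡ + 0 ℤ.+ f (inj₁ tt)
  classify-base f tt = sym (ℤP.+-identityˡ _)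

-- A loop is encoded as a word balanced against the empty word, which forces its total rise to vanish.
module _ {len : Fin 2 → ℕ} (nonempty : ∀ i → 1 ≤ len i) where

  open Loops 2 len nonempty

  HasN-bouquet : ∀ {k} → Card (StepTriple (len 0F) (len 1F) 0) k → HasN G k
  HasN-bouquet card = StepCoding⇒HasN record
    { Code = StepTriple (len 0F) (len 1F) 0
    ; card = card
    ; base = λ _ _ → + 0
    ; steps = steps
    ; consistent = λ d → zero-consistent {steps d} (rise≡0 d)
    ; base-b₀ = λ _ → refl
    ; few-flats = few-flats
    ; base-reaches-b₀ = λ { _ tt → ε }
    ; steps-injective = λ { d@((_ , _ , ([] , _)) , _) d′@((_ , _ , ([] , _)) , _) same →
                            StepTriple-≡ d d′ (same 0F) (same 1F) refl }
    ; classify = classify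
    ; classify-steps = λ { f v 0F → refl ; f v 1F → refl }
    ; classify-base = λ f _ → classify-base f
    }
    where
    Code = StepTriple (len 0F) (len 1F) 0
    steps : Code → Steps
    steps (((w₁ , _) , _) , _) 0F = w₁
    steps ((_ , (w₂ , _) , _) , _) 1F = w₂
    rise≡0 : ∀ d i → totalRise (steps d i) ≡ + 0
    rise≡0 ((_ , _ , ([] , _)) , _ , e₁₂ , e₂₃) 0F = trans e₁₂ e₂₃
    rise≡0 ((_ , _ , ([] , _)) , _ , _ , e₂₃) 1F = e₂₃
    few-flats : ∀ d i → flats (steps d i) ≤ 1
    few-flats (((_ , l₁) , _) , _) 0F = l₁
    few-flats ((_ , (_ , l₂) , _) , _) 1F = l₂
    classify : ∀ f → IsValid G f → Code
    classify f v = ((stepsOf f 0F , ≤1 0F) , (stepsOf f 1F , ≤1 1F) , ([] , z≤n)) ,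
      ℕP.+-mono-≤ (ℕP.+-mono-≤ (≤1 0F) (≤1 1F)) (z≤n {0}) ,
      trans (loop-rise≡0 f v 0F) (sym (loop-rise≡0 f v 1F)) , loop-rise≡0 f v 1F
      where ≤1 = valid⇒flats≤1 f v

module _ {len : Fin 1 → ℕ} (nonempty : ∀ i → 1 ≤ len i) where

  open Loops 1 len nonempty

  HasN-loop : ∀ {k} → Card (StepTriple (len 0F) 0 0) k → HasN G k
  HasN-loop card = StepCoding⇒HasN record
    { Code = StepTriple (len 0F) 0 0
    ; card = card
    ; base = λ _ _ → + 0
    ; steps = steps
    ; consistent = λ d → zero-consistent {steps d} (rise≡0 d)
    ; base-b₀ = λ _ → refl
    ; few-flats = λ { (((_ , l₁) , _) , _) 0F → l₁ }
    ; base-reaches-b₀ = λ { _ tt → ε }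
    ; steps-injective = λ { d@((_ , ([] , _) , ([] , _)) , _) d′@((_ , ([] , _) , ([] , _)) , _) same →
                            StepTriple-≡ d d′ (same 0F) refl refl }
    ; classify = classify
    ; classify-steps = λ { f v 0F → refl }
    ; classify-base = λ f _ → classify-base f
    }
    where
    Code = StepTriple (len 0F) 0 0
    steps : Code → Steps
    steps (((w₁ , _) , _) , _) 0F = w₁
    rise≡0 : ∀ d i → totalRise (steps d i) ≡ + 0
    rise≡0 ((_ , ([] , _) , ([] , _)) , _ , e₁₂ , e₂₃) 0F = trans e₁₂ e₂₃
    classify : ∀ f → IsValid G f → Code
    classify f v = ((stepsOf f 0F , ≤1) , ([] , z≤n) , ([] , z≤n)) ,
      ℕP.+-mono-≤ (ℕP.+-mono-≤ {_} {1} ≤1 (z≤n {1})) (z≤n {0}) , loop-rise≡0 f v 0F , refl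
      where ≤1 = valid⇒flats≤1 f v 0F

-- Parity bookkeeping and the counts

even⇒pred-odd : ∀ {x} → 1 ≤ x → Even x → Odd (x ∸ 1)
even⇒pred-odd {suc x} _ = go x
  where
  go : ∀ y → suc y % 2 ≡ 0 → y % 2 ≡ 1
  go (suc zero) _ = refl
  go (suc (suc y)) e = go y e

odd⇒pred-even : ∀ {x} → 1 ≤ x → Odd x → Even (x ∸ 1)
odd⇒pred-even {suc x} _ = go x
  where
  go : ∀ y → suc y % 2 ≡ 1 → y % 2 ≡ 0
  go zero _ = refl
  go (suc (suc y)) e = go y e

same-parity : ∀ x y {p} → x % 2 ≡ p → y % 2 ≡ p → SameParity x y
same-parity x y px py = trans px (sym py)

even≠odd : ∀ x y → Even x → Odd y → ¬ SameParity x y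
even≠odd x y ex oy e with trans (sym ex) (trans e oy)
... | ()

odd≠even : ∀ x y → Odd x → Even y → ¬ SameParity x y
odd≠even x y ox ey e = even≠odd y x ey ox (sym e)

even0 : Even 0
even0 = refl

odd1 : Odd 1
odd1 = refl

parity-cases : ∀ x → Even x ⊎ Odd x
parity-cases zero = inj₁ refl
parity-cases (suc zero) = inj₂ refl
parity-cases (suc (suc x)) = parity-cases x

pred-flips : ∀ {x} → 1 ≤ x → ¬ SameParity x (x ∸ 1)
pred-flips {suc x} _ = go x
  where
  go : ∀ y → ¬ SameParity (suc y) y
  go (suc (suc y)) = go y

pred-keeps-other : ∀ x {y} → 1 ≤ y → ¬ SameParity x y → SameParity x (y ∸ 1)
pred-keeps-other x {y} 1≤y x≁y with parity-cases x | parity-cases y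
... | inj₁ ex | inj₁ ey = ⊥-elim (x≁y (same-parity x y ex ey))
... | inj₁ ex | inj₂ oy = same-parity x (y ∸ 1) ex (odd⇒pred-even 1≤y oy)
... | inj₂ ox | inj₁ ey = same-parity x (y ∸ 1) ox (even⇒pred-odd 1≤y ey)
... | inj₂ ox | inj₂ oy = ⊥-elim (x≁y (same-parity x y ox oy))

≁pred : ∀ x {y} → 1 ≤ y → SameParity x y → ¬ SameParity x (y ∸ 1)
≁pred x 1≤y x∼y x∼y-1 = pred-flips 1≤y (trans (sym x∼y) x∼y-1)

pred≁ : ∀ {x} y → 1 ≤ x → SameParity x y → ¬ SameParity (x ∸ 1) y
pred≁ y 1≤x x∼y x-1∼y = pred-flips 1≤x (trans x∼y (sym x-1∼y))

HasN-CB : ∀ {x₁ x₂ x₃ k} → 1 ≤ x₁ → 1 ≤ x₂ → 1 ≤ x₃ → Card (StepTriple x₁ x₂ x₃) k → HasN (CB x₁ x₂ x₃) k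
HasN-CB l₁ l₂ l₃ = HasN-theta (λ { 0F → l₁ ; 1F → l₂ ; 2F → l₃ })

-- With all three lengths of one parity, only flat-free configurations balance.
N-CB-same-parity : ∀ x₁ x₂ x₃ → 1 ≤ x₁ → 1 ≤ x₂ → 1 ≤ x₃ → SameParity x₁ x₂ → SameParity x₂ x₃ →
  HasN (CB x₁ x₂ x₃) (F x₁ x₂ x₃)
N-CB-same-parity x₁ x₂ x₃ l₁ l₂ l₃ p₁₂ p₂₃ = HasN-CB l₁ l₂ l₃ (subst (Card _) (only-first x₁ x₂ x₃ _)
  (card-StepTriple x₁ x₂ x₃
    (card-Balanced3 x₁ x₂ x₃ p₁₂ p₂₃)
    (Balanced3-empty₂₃ x₁ x₂ _ (≁pred x₂ l₃ p₂₃))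
    (Balanced3-empty₁₂ x₁ _ x₃ (≁pred x₁ l₂ p₁₂))
    (Balanced3-empty₁₂ x₁ _ _ (≁pred x₁ l₂ p₁₂))
    (Balanced3-empty₁₂ _ x₂ x₃ (pred≁ x₂ l₁ p₁₂))
    (Balanced3-empty₁₂ _ x₂ _ (pred≁ x₂ l₁ p₁₂))
    (Balanced3-empty₂₃ _ _ x₃ (pred≁ x₃ l₂ p₂₃))))
  where
  only-first : ∀ x₁ x₂ x₃ a → a + x₃ * 0 + x₂ * 0 + x₂ * x₃ * 0 + x₁ * 0 + x₁ * x₃ * 0 + x₁ * x₂ * 0 ≡ a
  only-first = solve-∀

-- With x₃ of the other parity, a balanced configuration has a flat step either on
-- the third path alone or on each of the first two.
N-CB-odd-last : ∀ x₁ x₂ x₃ → 1 ≤ x₁ → 1 ≤ x₂ → 1 ≤ x₃ → SameParity x₁ x₂ → ¬ SameParity x₂ x₃ →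
  HasN (CB x₁ x₂ x₃) (x₃ * F x₁ x₂ (x₃ ∸ 1) + x₁ * x₂ * F (x₁ ∸ 1) (x₂ ∸ 1) x₃)
N-CB-odd-last x₁ x₂ x₃ l₁ l₂ l₃ p₁₂ n₂₃ = HasN-CB l₁ l₂ l₃ (subst (Card _) (arrange x₁ x₂ x₃ _ _)
  (card-StepTriple x₁ x₂ x₃
    (Balanced3-empty₂₃ x₁ x₂ x₃ n₂₃)
    (card-Balanced3 x₁ x₂ _ p₁₂ (pred-keeps-other x₂ l₃ n₂₃))
    (Balanced3-empty₁₂ x₁ _ x₃ (≁pred x₁ l₂ p₁₂))
    (Balanced3-empty₁₂ x₁ _ _ (≁pred x₁ l₂ p₁₂))
    (Balanced3-empty₁₂ _ x₂ x₃ (pred≁ x₂ l₁ p₁₂))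
    (Balanced3-empty₁₂ _ x₂ _ (pred≁ x₂ l₁ p₁₂))
    (card-Balanced3 _ _ x₃ (pred-keeps-other (x₁ ∸ 1) l₂ (pred≁ x₂ l₁ p₁₂))
                           (sym (pred-keeps-other x₃ l₂ (λ e → n₂₃ (sym e)))))))
  where
  arrange : ∀ x₁ x₂ x₃ a b → 0 + x₃ * a + x₂ * 0 + x₂ * x₃ * 0 + x₁ * 0 + x₁ * x₃ * 0 + x₁ * x₂ * b ≡ x₃ * a + x₁ * x₂ * b
  arrange = solve-∀

N-CB-odd-first : ∀ x₁ x₂ x₃ → 1 ≤ x₁ → 1 ≤ x₂ → 1 ≤ x₃ → ¬ SameParity x₁ x₂ → SameParity x₂ x₃ →
  HasN (CB x₁ x₂ x₃) (x₁ * F (x₁ ∸ 1) x₂ x₃ + x₂ * x₃ * F x₁ (x₂ ∸ 1) (x₃ ∸ 1))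
N-CB-odd-first x₁ x₂ x₃ l₁ l₂ l₃ n₁₂ p₂₃ = HasN-CB l₁ l₂ l₃ (subst (Card _) (arrange x₁ x₂ x₃ _ _)
  (card-StepTriple x₁ x₂ x₃
    (Balanced3-empty₁₂ x₁ x₂ x₃ n₁₂)
    (Balanced3-empty₂₃ x₁ x₂ _ (≁pred x₂ l₃ p₂₃))
    (Balanced3-empty₂₃ x₁ _ x₃ (pred≁ x₃ l₂ p₂₃))
    (card-Balanced3 x₁ _ _ (pred-keeps-other x₁ l₂ n₁₂) (pred-keeps-other (x₂ ∸ 1) l₃ (pred≁ x₃ l₂ p₂₃)))
    (card-Balanced3 _ x₂ x₃ (sym (pred-keeps-other x₂ l₁ (λ e → n₁₂ (sym e)))) p₂₃)
    (Balanced3-empty₂₃ _ x₂ _ (≁pred x₂ l₃ p₂₃))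
    (Balanced3-empty₂₃ _ _ x₃ (pred≁ x₃ l₂ p₂₃))))
  where
  arrange : ∀ x₁ x₂ x₃ a b → 0 + x₃ * 0 + x₂ * 0 + x₂ * x₃ * b + x₁ * a + x₁ * x₃ * 0 + x₁ * x₂ * 0 ≡ x₁ * a + x₂ * x₃ * b
  arrange = solve-∀

HasN-Wedge : ∀ {a b k} → 1 ≤ a → 1 ≤ b → Card (StepTriple a b 0) k → HasN (Wedge a b) k
HasN-Wedge l₁ l₂ = HasN-bouquet (λ { 0F → l₁ ; 1F → l₂ })

N-Wedge-even : ∀ a b → 1 ≤ a → 1 ≤ b → Even a → Even b → HasN (Wedge a b) (F a b 0)
N-Wedge-even a b l₁ l₂ ea eb = HasN-Wedge l₁ l₂ (subst (Card _) (arrange a b _)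
  (card-StepTriple a b 0
    (card-Balanced3 a b 0 a∼b b∼0)
    (card-Balanced3 a b 0 a∼b b∼0)
    (Balanced3-empty₁₂ a _ 0 (≁pred a l₂ a∼b))
    (Balanced3-empty₁₂ a _ 0 (≁pred a l₂ a∼b))
    (Balanced3-empty₁₂ _ b 0 (pred≁ b l₁ a∼b))
    (Balanced3-empty₁₂ _ b 0 (pred≁ b l₁ a∼b))
    (Balanced3-empty₂₃ _ _ 0 (pred≁ 0 l₂ b∼0))))
  where
  a∼b = same-parity a b ea eb
  b∼0 = same-parity b 0 eb even0
  arrange : ∀ a b k → k + 0 * k + b * 0 + b * 0 * 0 + a * 0 + a * 0 * 0 + a * b * 0 ≡ k
  arrange = solve-∀

HasN-Cycle : ∀ {a k} → 1 ≤ a → Card (StepTriple a 0 0) k → HasN (Cycle a) k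
HasN-Cycle l = HasN-loop (λ { 0F → l })

N-Cycle-even : ∀ a → 1 ≤ a → Even a → HasN (Cycle a) (F a 0 0)
N-Cycle-even a l ea = HasN-Cycle l (subst (Card _) (arrange a _)
  (card-StepTriple a 0 0 c c c c
    e e e))
  where
  a∼0 = same-parity a 0 ea even0
  c = card-Balanced3 a 0 0 a∼0 refl
  e = Balanced3-empty₁₂ (a ∸ 1) 0 0 (pred≁ 0 l a∼0)
  arrange : ∀ a k → k + 0 * k + 0 * k + 0 * 0 * k + a * 0 + a * 0 * 0 + a * 0 * 0 ≡ k
  arrange = solve-∀

F-swap₁₂ : ∀ x y z → SameParity x y → SameParity y z → F x y z ≡ F y x z
F-swap₁₂ x y z x∼y y∼z = ↔⇒≡ (↔-sym (card-Balanced3 x y z x∼y y∼z) ⨾ Balanced3-swap₁₂ x y z ⨾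
  card-Balanced3 y x z (sym x∼y) (trans x∼y y∼z))

N-CB-even-even-1 : ∀ e₁ e₂ → Even e₁ → Even e₂ → 1 ≤ e₁ → 1 ≤ e₂ →
  HasN (CB e₁ e₂ 1) (e₁ * e₂ * F (e₁ ∸ 1) (e₂ ∸ 1) 1 + F e₁ e₂ 0)
N-CB-even-even-1 e₁ e₂ ev₁ ev₂ l₁ l₂ = subst (HasN (CB e₁ e₂ 1)) (ℕP.+-comm (F e₁ e₂ 0) _)
  (subst (λ k → HasN (CB e₁ e₂ 1) (k + e₁ * e₂ * F (e₁ ∸ 1) (e₂ ∸ 1) 1)) (ℕP.*-identityˡ (F e₁ e₂ 0))
    (N-CB-odd-last e₁ e₂ 1 l₁ l₂ (s≤s z≤n) (same-parity e₁ e₂ ev₁ ev₂) (even≠odd e₂ 1 ev₂ odd1)))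

N-CB-even-odd-1 : ∀ e₁ o₁ → Even e₁ → 1 ≤ e₁ → Odd o₁ → 1 ≤ o₁ →
  HasN (CB e₁ o₁ 1) (e₁ * F (e₁ ∸ 1) o₁ 1 + o₁ * F (o₁ ∸ 1) e₁ 0)
N-CB-even-odd-1 e₁ o₁ ev l₁ od l₂ =
  subst (λ k → HasN (CB e₁ o₁ 1) (e₁ * F (e₁ ∸ 1) o₁ 1 + k))
    (cong₂ _*_ (ℕP.*-identityʳ o₁) (F-swap₁₂ e₁ (o₁ ∸ 1) 0 (same-parity e₁ (o₁ ∸ 1) ev eva) (same-parity (o₁ ∸ 1) 0 eva even0)))
    (N-CB-odd-first e₁ o₁ 1 l₁ l₂ (s≤s z≤n) (even≠odd e₁ o₁ ev od) (same-parity o₁ 1 od odd1))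
  where
  eva : Even (o₁ ∸ 1)
  eva = odd⇒pred-even l₂ od

N-CB-even-1-1 : ∀ e₁ → Even e₁ → 1 ≤ e₁ → HasN (CB e₁ 1 1) (e₁ * F (e₁ ∸ 1) 1 1 + F e₁ 0 0)
N-CB-even-1-1 e₁ ev l₁ = subst (λ k → HasN (CB e₁ 1 1) (e₁ * F (e₁ ∸ 1) 1 1 + k)) (ℕP.*-identityˡ (F e₁ 0 0))
  (N-CB-odd-first e₁ 1 1 l₁ (s≤s z≤n) (s≤s z≤n) (even≠odd e₁ 1 ev odd1) refl)

suc≤⇒1≤ : ∀ {m n} → suc m ≤ n → 1 ≤ n
suc≤⇒1≤ = ℕP.≤-trans (s≤s z≤n)

uniform-parity : ∀ x₁ x₂ x₃ {p} → x₁ % 2 ≡ p × x₂ % 2 ≡ p × x₃ % 2 ≡ p → SameParity x₁ x₂ × SameParity x₂ x₃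
uniform-parity x₁ x₂ x₃ (p₁ , p₂ , p₃) = same-parity x₁ x₂ p₁ p₂ , same-parity x₂ x₃ p₂ p₃

corollary4p8 :
  -- (i)
  (∀ x₁ x₂ x₃ → 1 ≤ x₁ → 1 ≤ x₂ → 1 ≤ x₃ →
     (Even x₁ × Even x₂ × Even x₃) ⊎ (Odd x₁ × Odd x₂ × Odd x₃) →
     HasN (CB x₁ x₂ x₃) (F x₁ x₂ x₃))
  ×
  -- (ii)
  ((∀ o₁ o₂ e₁ → Odd o₁ → Odd o₂ → Even e₁ → 2 ≤ o₁ → 2 ≤ o₂ → 2 ≤ e₁ →
     HasN (CB o₁ o₂ e₁)
       (e₁ * F o₁ o₂ (e₁ ∸ 1) + o₁ * o₂ * F (o₁ ∸ 1) (o₂ ∸ 1) e₁))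
   ×
   (∀ e₁ e₂ o₁ → Even e₁ → Even e₂ → Odd o₁ → 2 ≤ e₁ → 2 ≤ e₂ → 2 ≤ o₁ →
     HasN (CB e₁ e₂ o₁)
       (o₁ * F e₁ e₂ (o₁ ∸ 1) + e₁ * e₂ * F (e₁ ∸ 1) (e₂ ∸ 1) o₁)))
  ×
  -- (iii)
  (∀ e₁ e₂ → Even e₁ → Even e₂ → 1 ≤ e₁ → 1 ≤ e₂ →
     Σ ℕ λ k → HasN (Wedge e₁ e₂) k ×
       HasN (CB e₁ e₂ 1) (e₁ * e₂ * F (e₁ ∸ 1) (e₂ ∸ 1) 1 + k))
  ×
  -- (iv)
  (∀ e₁ o₁ → Even e₁ → 1 ≤ e₁ → Odd o₁ → 3 ≤ o₁ →
     Σ ℕ λ k → HasN (Wedge (o₁ ∸ 1) e₁) k ×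
       HasN (CB e₁ o₁ 1) (e₁ * F (e₁ ∸ 1) o₁ 1 + o₁ * k))
  ×
  -- (v)
  (∀ e₁ → Even e₁ → 1 ≤ e₁ →
     Σ ℕ λ k → HasN (Cycle e₁) k ×
       HasN (CB e₁ 1 1) (e₁ * F (e₁ ∸ 1) 1 1 + k))
corollary4p8 = part-i , (part-ii-a , part-ii-b) , part-iii , part-iv , part-v
  where
  part-i = λ x₁ x₂ x₃ l₁ l₂ l₃ parities → uncurry (N-CB-same-parity x₁ x₂ x₃ l₁ l₂ l₃)
    ([ uniform-parity x₁ x₂ x₃ , uniform-parity x₁ x₂ x₃ ]′ parities)
  part-ii-a = λ o₁ o₂ e₁ od₁ od₂ ev l₁ l₂ l₃ → N-CB-odd-last o₁ o₂ e₁ (suc≤⇒1≤ l₁) (suc≤⇒1≤ l₂) (suc≤⇒1≤ l₃)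
    (same-parity o₁ o₂ od₁ od₂) (odd≠even o₂ e₁ od₂ ev)
  part-ii-b = λ e₁ e₂ o₁ ev₁ ev₂ od l₁ l₂ l₃ → N-CB-odd-last e₁ e₂ o₁ (suc≤⇒1≤ l₁) (suc≤⇒1≤ l₂) (suc≤⇒1≤ l₃)
    (same-parity e₁ e₂ ev₁ ev₂) (even≠odd e₂ o₁ ev₂ od)
  part-iii = λ e₁ e₂ ev₁ ev₂ l₁ l₂ → F e₁ e₂ 0 , N-Wedge-even e₁ e₂ l₁ l₂ ev₁ ev₂ , N-CB-even-even-1 e₁ e₂ ev₁ ev₂ l₁ l₂
  part-iv = λ e₁ o₁ ev l₁ od l₃ → F (o₁ ∸ 1) e₁ 0 ,
    N-Wedge-even (o₁ ∸ 1) e₁ (suc≤⇒1≤ (ℕP.∸-monoˡ-≤ 1 l₃)) l₁ (odd⇒pred-even (suc≤⇒1≤ l₃) od) ev ,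
    N-CB-even-odd-1 e₁ o₁ ev l₁ od (suc≤⇒1≤ l₃)
  part-v = λ e₁ ev l₁ → F e₁ 0 0 , N-Cycle-even e₁ l₁ ev , N-CB-even-1-1 e₁ ev l₁
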